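{- Let $q\ge4$ and let $\ell$ be a line of $PG(2,q)$. Let $P,Q$ be distinct points of $\ell$ and let $R,S,T$ be pairwise distinct points not on $\ell$ such that $P,R,S,T$ are collinear. Then $A=(\ell\setminus\{P,Q\})\cup\{R,S,T\}$ is a minimal $(1,2)$-saturating set of size $q+2$ in $PG(2,q)$.
   Context: For a set $A$ of points in $PG(2,q)$ and a line $m$, the multiplicity of $m$ is $\binom{|m\cap A|}{2}$; a secant is a line with $|m\cap A|\ge2$. A set $A$ of $n$ points is $(1,\mu)$-saturating if it spans $PG(2,q)$, $A\ne PG(2,q)$, and every point not in $A$ lies on secants of $A$ whose multiplicities sum to at least $\mu$. A $(1,\mu)$-saturating $n$-set is minimal if it does not contain a $(1,\mu)$-saturating set of size $n-1$. -}

module Defs where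

open import Level using (0ℓ)
open import Data.Nat using (ℕ; zero; suc; _∸_; _≤_)
open import Data.Nat.Combinatorics using (_C_)
open import Data.Bool using (Bool; true; false; _∧_; _∨_; not; if_then_else_)
open import Data.List using (List; []; _∷_; _++_; map; concatMap; filter; length)
open import Data.Nat.ListAction using (sum)
open import Data.List.Membership.Propositional using (_∈_)
open import Data.List.Relation.Unary.Unique.Propositional using (Unique)
open import Data.Product using (Σ; ∃; _×_; _,_)
open import Relation.Nullary using (¬_; does)
open import Relation.Binary.PropositionalEquality using (_≡_; _≢_)
open import Relation.Binary.Definitions using (DecidableEquality)
open import Algebra.Structures using (IsCommutativeRing)

record FiniteField : Set₁ where
  field
    F      : Set
    _+_    : F → F → F
    _*_    : F → F → F
    -_     : F → F
    0#     : F
    1#     : F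
    isCommutativeRing : IsCommutativeRing _≡_ _+_ _*_ -_ 0# 1#
    0≢1    : 0# ≢ 1#
    inverse : ∀ x → x ≢ 0# → Σ F (λ y → x * y ≡ 1#)
    _≟_    : DecidableEquality F
    elements : List F
    complete : ∀ x → x ∈ elements
    unique   : Unique elements

  order : ℕ
  order = length elements

-- PG(2,q) over a finite field K.  Points (and, dually, lines) are given
-- by their unique normalised homogeneous coordinates: the first nonzero
-- coordinate equals 1.

module PG2 (K : FiniteField) where
  open FiniteField K

  data Point : Set where
    p1 : F → F → Point
    p2 : F → Point
    p3 : Point

  -- Lines use the same normalised coordinates [a : b : c], the line
  -- being {(x:y:z) | a x + b y + c z = 0}.
  Line : Set
  Line = Point

  coords : Point → F × F × F
  coords (p1 y z) = 1# , y , z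
  coords (p2 z)   = 0# , 1# , z
  coords p3       = 0# , 0# , 1#

  allPoints : List Point
  allPoints = concatMap (λ y → map (p1 y) elements) elements
              ++ map p2 elements ++ (p3 ∷ [])

  allLines : List Line
  allLines = allPoints

  _==_ : Point → Point → Bool
  p1 a b == p1 c d = does (a ≟ c) ∧ does (b ≟ d)
  p2 a   == p2 c   = does (a ≟ c)
  p3     == p3     = true
  _      == _      = false

  incident : Point → Line → Bool
  incident X m with coords X | coords m
  ... | (x , y , z) | (a , b , c) = does ((((a * x) + (b * y)) + (c * z)) ≟ 0#)

  PointSet : Set
  PointSet = Point → Bool

  count : (Point → Bool) → ℕ
  count P = length (filter (λ X → P X Data.Bool.≟ true) allPoints)

  size : PointSet → ℕ
  size A = count A

  meet : PointSet → Line → ℕ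
  meet A m = count (λ X → incident X m ∧ A X)

  multiplicity : PointSet → Line → ℕ
  multiplicity A m = meet A m C 2

  isSecant : PointSet → Line → Bool
  isSecant A m = does (2 Data.Nat.≤? meet A m)

  secantWeight : PointSet → Point → ℕ
  secantWeight A X =
    sum (map (multiplicity A)
             (filter (λ m → (incident X m ∧ isSecant A m) Data.Bool.≟ true)
                     allLines))

  Spans : PointSet → Set
  Spans A = ¬ (Σ Line (λ m → ∀ X → A X ≡ true → incident X m ≡ true))

  ProperSubset : PointSet → Set
  ProperSubset A = Σ Point (λ X → A X ≡ false)

  Saturating : ℕ → PointSet → Set
  Saturating μ A =
    Spans A × ProperSubset A ×
    (∀ X → A X ≡ false → μ ≤ secantWeight A X)

  _⊆_ : PointSet → PointSet → Set
  B ⊆ A = ∀ X → B X ≡ true → A X ≡ true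

  MinimalSaturating : ℕ → PointSet → Set
  MinimalSaturating μ A =
    Saturating μ A ×
    (∀ B → B ⊆ A → size B ≡ size A ∸ 1 → ¬ Saturating μ B)

  theSet : Line → Point → Point → Point → Point → Point → PointSet
  theSet ℓ P Q R S T X =
    (incident X ℓ ∧ not (X == P) ∧ not (X == Q))
    ∨ (X == R) ∨ (X == S) ∨ (X == T)

-- Since ℓ has q + 1 ≥ 5 points, A has
-- q + 2 points and is not contained in a line.  Every point outside A is covered at least twice:
-- a point of m lies on the secant m carrying R, S, T; Q lies on ℓ, carrying q − 1 ≥ 3 points of A;
-- a point X off ℓ ∪ m sees R, S, T along three distinct lines, which meet ℓ in three distinct
-- points other than P, at most one of them Q, so two of these lines are secants.
-- For minimality, a saturating B ⊆ A of size q + 1 lies in A ∖ {Y} for some Y ∈ A, and weights are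
-- monotone, so it suffices to exhibit a point outside A ∖ {Y} of weight at most 1: Y itself if
-- Y ∈ {R, S, T} (only m is a secant through it), and otherwise X₀ = YR ∩ QS, whose only possible
-- secant is X₀T.

module Submission where

open import Defs

module Booleans where
  open import Data.Nat using (ℕ)
  open import Data.Bool using (Bool; true; false; _∧_; _∨_; not; if_then_else_)
  open import Data.Product using (_×_; _,_)
  open import Data.Sum using (_⊎_; inj₁; inj₂)
  open import Relation.Nullary using (¬_; Dec; does; yes; no)
  open import Relation.Binary.PropositionalEquality using (_≡_; refl)

  [_] : Bool → ℕ
  [ b ] = if b then 1 else 0

  ∧≡true : ∀ {a b} → (a ∧ b) ≡ true → a ≡ true × b ≡ true
  ∧≡true {true} {true} _ = refl , refl

  ∨≡true : ∀ {a b} → (a ∨ b) ≡ true → a ≡ true ⊎ b ≡ true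
  ∨≡true {true}  _   = inj₁ refl
  ∨≡true {false} b≡t = inj₂ b≡t

  ∨≡true-introʳ : ∀ a {b} → b ≡ true → (a ∨ b) ≡ true
  ∨≡true-introʳ true  _   = refl
  ∨≡true-introʳ false b≡t = b≡t

  not≡true : ∀ {b} → not b ≡ true → b ≡ false
  not≡true {false} _ = refl

  does≡true⇒ : ∀ {P : Set} (P? : Dec P) → does P? ≡ true → P
  does≡true⇒ (yes p) _ = p

  does≡false⇒¬ : ∀ {P : Set} (P? : Dec P) → does P? ≡ false → ¬ P
  does≡false⇒¬ (no ¬p) _ = ¬p

module ListSums where
  open import Function using (_∘_)
  open import Data.Nat using (ℕ; zero; suc; _+_; _≤_; _<_; z≤n; s≤s)
  open import Data.Nat.Properties using (+-identityʳ; +-mono-≤; ≤-trans; m≤m+n; m≤n+m; +-commutativeSemigroup)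
  open import Data.Nat.ListAction using (sum)
  open import Data.Nat.ListAction.Properties using (sum-++)
  open import Data.Bool using (Bool; true; false; if_then_else_)
  import Data.Bool as Bool
  open import Data.List using (List; []; _∷_; _++_; map; concatMap; filter; length)
  open import Data.List.Properties using (map-++; map-cong; map-cong-local)
  open import Data.List.Membership.Propositional using (_∈_)
  open import Data.List.Relation.Unary.Any using (here; there)
  open import Data.List.Relation.Unary.All as All using (All; []; _∷_)
  open import Data.List.Relation.Unary.AllPairs using ([]; _∷_)
  open import Data.List.Relation.Unary.Unique.Propositional using (Unique)
  open import Data.Product using (∃; _,_)
  open import Relation.Nullary using (does)
  open import Relation.Nullary.Decidable using (dec-true; dec-false)
  open import Relation.Binary.Definitions using (DecidableEquality)
  open import Relation.Binary.PropositionalEquality hiding ([_])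
  open import Algebra.Properties.CommutativeSemigroup +-commutativeSemigroup using (interchange)
  open Booleans using ([_])

  module _ {A : Set} where

    length-filter≡sum : (f : A → Bool) (xs : List A) →
      length (filter (λ x → f x Bool.≟ true) xs) ≡ sum (map (λ x → [ f x ]) xs)
    length-filter≡sum f [] = refl
    length-filter≡sum f (x ∷ xs) with f x
    ... | true  = cong suc (length-filter≡sum f xs)
    ... | false = length-filter≡sum f xs

    sum-map-filter≡sum : (p : A → Bool) (f : A → ℕ) (xs : List A) →
      sum (map f (filter (λ x → p x Bool.≟ true) xs)) ≡ sum (map (λ x → if p x then f x else 0) xs)
    sum-map-filter≡sum p f [] = refl
    sum-map-filter≡sum p f (x ∷ xs) with p x
    ... | true  = cong (f x +_) (sum-map-filter≡sum p f xs)
    ... | false = sum-map-filter≡sum p f xs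

    sum-map-++ : (f : A → ℕ) (xs ys : List A) → sum (map f (xs ++ ys)) ≡ sum (map f xs) + sum (map f ys)
    sum-map-++ f xs ys = trans (cong sum (map-++ f xs ys)) (sum-++ (map f xs) (map f ys))

    sum-map-concatMap : (f : A → ℕ) {B : Set} (g : B → List A) (ys : List B) →
      sum (map f (concatMap g ys)) ≡ sum (map (λ y → sum (map f (g y))) ys)
    sum-map-concatMap f g [] = refl
    sum-map-concatMap f g (y ∷ ys) =
      trans (sum-map-++ f (g y) (concatMap g ys)) (cong (sum (map f (g y)) +_) (sum-map-concatMap f g ys))

    sum-map-+ : (f g : A → ℕ) (xs : List A) →
      sum (map (λ x → f x + g x) xs) ≡ sum (map f xs) + sum (map g xs)
    sum-map-+ f g [] = refl
    sum-map-+ f g (x ∷ xs) =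
      trans (cong (f x + g x +_) (sum-map-+ f g xs)) (interchange (f x) (g x) _ _)

    sum-map-mono : {f g : A → ℕ} → (∀ x → f x ≤ g x) → (xs : List A) → sum (map f xs) ≤ sum (map g xs)
    sum-map-mono f≤g [] = z≤n
    sum-map-mono f≤g (x ∷ xs) = +-mono-≤ (f≤g x) (sum-map-mono f≤g xs)

    sum-map-const-1 : (xs : List A) → sum (map (λ _ → 1) xs) ≡ length xs
    sum-map-const-1 [] = refl
    sum-map-const-1 (x ∷ xs) = cong suc (sum-map-const-1 xs)

    sum-map-zero : {f : A → ℕ} {xs : List A} → All (λ x → f x ≡ 0) xs → sum (map f xs) ≡ 0
    sum-map-zero [] = refl
    sum-map-zero (fx≡0 ∷ fxs≡0) = cong₂ _+_ fx≡0 (sum-map-zero fxs≡0)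

    sum-map-single : (f : A → ℕ) {b : A} {xs : List A} → Unique xs → b ∈ xs →
      (∀ x → x ≢ b → f x ≡ 0) → sum (map f xs) ≡ f b
    sum-map-single f (b∉xs ∷ _) (here refl) vanish =
      trans (cong (f _ +_) (sum-map-zero (All.map (λ b≢x → vanish _ (b≢x ∘ sym)) b∉xs))) (+-identityʳ _)
    sum-map-single f (x∉xs ∷ xs!) (there b∈xs) vanish =
      cong₂ _+_ (vanish _ (All.lookup x∉xs b∈xs)) (sum-map-single f xs! b∈xs vanish)

    sum-map-≥ : (f : A → ℕ) {b : A} {xs : List A} → b ∈ xs → f b ≤ sum (map f xs)
    sum-map-≥ f {xs = x ∷ xs} (here refl) = m≤m+n (f x) _
    sum-map-≥ f {xs = x ∷ xs} (there b∈xs) = ≤-trans (sum-map-≥ f b∈xs) (m≤n+m _ (f x))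

    sum-map-positive : (f : A → ℕ) (xs : List A) → 0 < sum (map f xs) → ∃ λ x → 0 < f x
    sum-map-positive f (x ∷ xs) pos with f x in fx
    ... | suc _ = x , subst (0 <_) (sym fx) (s≤s z≤n)
    ... | zero  = sum-map-positive f xs pos

    module _ (_≟_ : DecidableEquality A) where

      sum-map-≥-unique : (f : A → ℕ) {bs : List A} (xs : List A) → Unique bs →
        (∀ {b} → b ∈ bs → b ∈ xs) → sum (map f bs) ≤ sum (map f xs)
      sum-map-≥-unique f xs [] _ = z≤n
      sum-map-≥-unique f {b ∷ bs} xs (b∉bs ∷ bs!) bs⊆xs = begin
        f b + sum (map f bs)
          ≡⟨ cong (λ ys → f b + sum ys) (map-cong-local (All.map off-b-elsewhere b∉bs)) ⟩
        f b + sum (map off-b bs)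
          ≤⟨ +-mono-≤ (subst (_≤ sum (map at-b xs)) at-b-b (sum-map-≥ at-b (bs⊆xs (here refl))))
                      (sum-map-≥-unique off-b xs bs! (bs⊆xs ∘ there)) ⟩
        sum (map at-b xs) + sum (map off-b xs)
          ≡⟨ sum-map-+ at-b off-b xs ⟨
        sum (map (λ x → at-b x + off-b x) xs)
          ≡⟨ cong sum (map-cong split xs) ⟩
        sum (map f xs) ∎
        where
        open Data.Nat.Properties.≤-Reasoning
        at-b off-b : A → ℕ
        at-b x = if does (x ≟ b) then f x else 0
        off-b x = if does (x ≟ b) then 0 else f x
        at-b-b : at-b b ≡ f b
        at-b-b rewrite dec-true (b ≟ b) refl = refl
        off-b-elsewhere : ∀ {x} → b ≢ x → f x ≡ off-b x
        off-b-elsewhere {x} b≢x rewrite dec-false (x ≟ b) (b≢x ∘ sym) = refl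
        split : ∀ x → at-b x + off-b x ≡ f x
        split x with does (x ≟ b)
        ... | true  = +-identityʳ (f x)
        ... | false = refl


module Coordinates (K : FiniteField) where
  open import Level using (0ℓ)
  open import Algebra.Bundles using (CommutativeRing)
  open import Function using (_∘_)
  open import Data.Product using (Σ; _×_; _,_; proj₁)
  open import Data.Empty using (⊥-elim)
  open import Data.Bool using (true)
  open import Relation.Nullary using (¬_; does; yes; no)
  open import Relation.Binary.PropositionalEquality
  open FiniteField K using (F; _≟_; inverse; 0≢1; isCommutativeRing)
  open PG2 K using (Point; Line; p1; p2; p3; coords; incident)

  ring : CommutativeRing 0ℓ 0ℓ
  ring = record { isCommutativeRing = isCommutativeRing }

  open CommutativeRing ring
    using ( _+_; _*_; -_; 0#; 1#; +-identityˡ; +-identityʳ; *-identityˡ; *-identityʳ; *-comm; zeroˡ; zeroʳ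
          ; -‿inverseʳ; commutativeSemiring)
  open import Algebra.Solver.Ring.NaturalCoefficients.Default commutativeSemiring
    using (solve; _:=_; _:+_; _:*_; con)

  -- The solver only knows natural-number coefficients, so subtraction is
  -- written as multiplication by the atom -1#, and identities are proved
  -- as "difference = (1# + -1#) * t".
  -1# : F
  -1# = - 1#

  cancel-1 : ∀ t → (1# + -1#) * t ≡ 0#
  cancel-1 t = trans (cong (_* t) (-‿inverseʳ 1#)) (zeroˡ t)

  t*≡0 : ∀ {t x} → x ≡ 0# → t * x ≡ 0#
  t*≡0 {t} refl = zeroʳ t

  ≡-from-difference : ∀ a b → a + -1# * b ≡ 0# → a ≡ b
  ≡-from-difference a b a-b≡0 = sym (begin
    b                         ≡⟨ +-identityʳ b ⟨
    b + 0#                    ≡⟨ cong (b +_) a-b≡0 ⟨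
    b + (a + -1# * b)         ≡⟨ solve 3 (λ m a b → b :+ (a :+ m :* b) := a :+ (con 1 :+ m) :* b) refl -1# a b ⟩
    a + (1# + -1#) * b        ≡⟨ cong (a +_) (cancel-1 b) ⟩
    a + 0#                    ≡⟨ +-identityʳ a ⟩
    a                         ∎)
    where open ≡-Reasoning

  Vec3 : Set
  Vec3 = F × F × F

  IsNull : Vec3 → Set
  IsNull (a , b , c) = (a ≡ 0#) × (b ≡ 0#) × (c ≡ 0#)

  scale : F → Vec3 → Vec3
  scale t (a , b , c) = t * a , t * b , t * c

  dot : Vec3 → Vec3 → F
  dot (a , b , c) (x , y , z) = a * x + b * y + c * z

  cross : Vec3 → Vec3 → Vec3
  cross (u₁ , u₂ , u₃) (v₁ , v₂ , v₃) =
    u₂ * v₃ + -1# * (u₃ * v₂) , u₃ * v₁ + -1# * (u₁ * v₃) , u₁ * v₂ + -1# * (u₂ * v₁)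

  _∥_ : Vec3 → Vec3 → Set
  (u₁ , u₂ , u₃) ∥ (v₁ , v₂ , v₃) =
    (u₂ * v₃ ≡ u₃ * v₂) × (u₃ * v₁ ≡ u₁ * v₃) × (u₁ * v₂ ≡ u₂ * v₁)

  dot-comm : ∀ u v → dot u v ≡ dot v u
  dot-comm (a , b , c) (x , y , z) =
    solve 6 (λ a b c x y z → a :* x :+ b :* y :+ c :* z := x :* a :+ y :* b :+ z :* c) refl a b c x y z

  dot-rotate : ∀ a b c x y z → dot (a , b , c) (x , y , z) ≡ dot (b , c , a) (y , z , x)
  dot-rotate = solve 6 (λ a b c x y z → a :* x :+ b :* y :+ c :* z := b :* y :+ c :* z :+ a :* x) refl

  dot-scaleˡ : ∀ t n u → dot (scale t n) u ≡ t * dot n u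
  dot-scaleˡ t (a , b , c) (x , y , z) =
    solve 7 (λ l a b c x y z → l :* a :* x :+ l :* b :* y :+ l :* c :* z := l :* (a :* x :+ b :* y :+ c :* z))
      refl t a b c x y z

  dot-crossˡ : ∀ u v → dot (cross u v) u ≡ 0#
  dot-crossˡ (u₁ , u₂ , u₃) (v₁ , v₂ , v₃) = trans expand (cancel-1 _)
    where
    expand : dot (cross (u₁ , u₂ , u₃) (v₁ , v₂ , v₃)) (u₁ , u₂ , u₃)
           ≡ (1# + -1#) * (u₁ * (u₂ * v₃) + u₂ * (u₃ * v₁) + u₁ * (u₃ * v₂))
    expand = solve 7 (λ m u₁ u₂ u₃ v₁ v₂ v₃ →
        (u₂ :* v₃ :+ m :* (u₃ :* v₂)) :* u₁ :+ (u₃ :* v₁ :+ m :* (u₁ :* v₃)) :* u₂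
          :+ (u₁ :* v₂ :+ m :* (u₂ :* v₁)) :* u₃
      := (con 1 :+ m) :* (u₁ :* (u₂ :* v₃) :+ u₂ :* (u₃ :* v₁) :+ u₁ :* (u₃ :* v₂)))
      refl -1# u₁ u₂ u₃ v₁ v₂ v₃

  dot-crossʳ : ∀ u v → dot (cross u v) v ≡ 0#
  dot-crossʳ (u₁ , u₂ , u₃) (v₁ , v₂ , v₃) = trans expand (cancel-1 _)
    where
    expand : dot (cross (u₁ , u₂ , u₃) (v₁ , v₂ , v₃)) (v₁ , v₂ , v₃)
           ≡ (1# + -1#) * (u₂ * (v₁ * v₃) + u₃ * (v₁ * v₂) + u₁ * (v₂ * v₃))
    expand = solve 7 (λ m u₁ u₂ u₃ v₁ v₂ v₃ →
        (u₂ :* v₃ :+ m :* (u₃ :* v₂)) :* v₁ :+ (u₃ :* v₁ :+ m :* (u₁ :* v₃)) :* v₂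
          :+ (u₁ :* v₂ :+ m :* (u₂ :* v₁)) :* v₃
      := (con 1 :+ m) :* (u₂ :* (v₁ :* v₃) :+ u₃ :* (v₁ :* v₂) :+ u₁ :* (v₂ :* v₃)))
      refl -1# u₁ u₂ u₃ v₁ v₂ v₃

  null-cross⇒∥ : ∀ u v → IsNull (cross u v) → u ∥ v
  null-cross⇒∥ u v (e₁ , e₂ , e₃) = ≡-from-difference _ _ e₁ , ≡-from-difference _ _ e₂ , ≡-from-difference _ _ e₃

  -- For n = u × v: w₂ n₃ − w₃ n₂ = v₁ (w · u) − u₁ (w · v).
  dot≡0⇒cross-minor : ∀ w₁ w₂ w₃ u₁ u₂ u₃ v₁ v₂ v₃ →
    dot (w₁ , w₂ , w₃) (u₁ , u₂ , u₃) ≡ 0# → dot (w₁ , w₂ , w₃) (v₁ , v₂ , v₃) ≡ 0# →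
    w₂ * (u₁ * v₂ + -1# * (u₂ * v₁)) ≡ w₃ * (u₃ * v₁ + -1# * (u₁ * v₃))
  dot≡0⇒cross-minor w₁ w₂ w₃ u₁ u₂ u₃ v₁ v₂ v₃ w⊥u w⊥v = begin
    w₂ * (u₁ * v₂ + -1# * (u₂ * v₁))
      ≡⟨ +-identityʳ _ ⟨
    w₂ * (u₁ * v₂ + -1# * (u₂ * v₁)) + 0#
      ≡⟨ cong (w₂ * (u₁ * v₂ + -1# * (u₂ * v₁)) +_) (vanishes w₃ (u₁ * v₃) v₁ w⊥u) ⟨
    w₂ * (u₁ * v₂ + -1# * (u₂ * v₁)) + ((1# + -1#) * (w₃ * (u₁ * v₃)) + v₁ * dot (w₁ , w₂ , w₃) (u₁ , u₂ , u₃))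
      ≡⟨ identity ⟩
    w₃ * (u₃ * v₁ + -1# * (u₁ * v₃)) + ((1# + -1#) * (w₂ * (u₂ * v₁)) + u₁ * dot (w₁ , w₂ , w₃) (v₁ , v₂ , v₃))
      ≡⟨ cong (w₃ * (u₃ * v₁ + -1# * (u₁ * v₃)) +_) (vanishes w₂ (u₂ * v₁) u₁ w⊥v) ⟩
    w₃ * (u₃ * v₁ + -1# * (u₁ * v₃)) + 0#
      ≡⟨ +-identityʳ _ ⟩
    w₃ * (u₃ * v₁ + -1# * (u₁ * v₃)) ∎
    where
    open ≡-Reasoning
    vanishes : ∀ a b c {d} → d ≡ 0# → (1# + -1#) * (a * b) + c * d ≡ 0#
    vanishes a b c refl = trans (cong₂ _+_ (cancel-1 (a * b)) (zeroʳ c)) (+-identityʳ 0#)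
    identity :
        w₂ * (u₁ * v₂ + -1# * (u₂ * v₁)) + ((1# + -1#) * (w₃ * (u₁ * v₃)) + v₁ * dot (w₁ , w₂ , w₃) (u₁ , u₂ , u₃))
      ≡ w₃ * (u₃ * v₁ + -1# * (u₁ * v₃)) + ((1# + -1#) * (w₂ * (u₂ * v₁)) + u₁ * dot (w₁ , w₂ , w₃) (v₁ , v₂ , v₃))
    identity = solve 10 (λ m w₁ w₂ w₃ u₁ u₂ u₃ v₁ v₂ v₃ →
        w₂ :* (u₁ :* v₂ :+ m :* (u₂ :* v₁))
          :+ ((con 1 :+ m) :* (w₃ :* (u₁ :* v₃)) :+ v₁ :* (w₁ :* u₁ :+ w₂ :* u₂ :+ w₃ :* u₃))
      := w₃ :* (u₃ :* v₁ :+ m :* (u₁ :* v₃))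
          :+ ((con 1 :+ m) :* (w₂ :* (u₂ :* v₁)) :+ u₁ :* (w₁ :* v₁ :+ w₂ :* v₂ :+ w₃ :* v₃)))
      refl -1# w₁ w₂ w₃ u₁ u₂ u₃ v₁ v₂ v₃

  dot≡0⇒∥-cross : ∀ w u v → dot w u ≡ 0# → dot w v ≡ 0# → w ∥ cross u v
  dot≡0⇒∥-cross (w₁ , w₂ , w₃) (u₁ , u₂ , u₃) (v₁ , v₂ , v₃) w⊥u w⊥v =
    dot≡0⇒cross-minor w₁ w₂ w₃ u₁ u₂ u₃ v₁ v₂ v₃ w⊥u w⊥v ,
    dot≡0⇒cross-minor w₂ w₃ w₁ u₂ u₃ u₁ v₂ v₃ v₁ w⊥u′ w⊥v′ ,
    dot≡0⇒cross-minor w₃ w₁ w₂ u₃ u₁ u₂ v₃ v₁ v₂ (trans (sym (dot-rotate w₂ w₃ w₁ u₂ u₃ u₁)) w⊥u′)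
                                               (trans (sym (dot-rotate w₂ w₃ w₁ v₂ v₃ v₁)) w⊥v′)
    where
    w⊥u′ : dot (w₂ , w₃ , w₁) (u₂ , u₃ , u₁) ≡ 0#
    w⊥u′ = trans (sym (dot-rotate w₁ w₂ w₃ u₁ u₂ u₃)) w⊥u
    w⊥v′ : dot (w₂ , w₃ , w₁) (v₂ , v₃ , v₁) ≡ 0#
    w⊥v′ = trans (sym (dot-rotate w₁ w₂ w₃ v₁ v₂ v₃)) w⊥v

  ∥-scaleʳ : ∀ w n t → w ∥ n → w ∥ scale t n
  ∥-scaleʳ (w₁ , w₂ , w₃) (n₁ , n₂ , n₃) t (e₁ , e₂ , e₃) = f e₁ , f e₂ , f e₃
    where
    f : ∀ {a b c d} → a * b ≡ c * d → a * (t * b) ≡ c * (t * d)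
    f {a} {b} {c} {d} e = begin
      a * (t * b) ≡⟨ solve 3 (λ t a b → a :* (t :* b) := t :* (a :* b)) refl t a b ⟩
      t * (a * b) ≡⟨ cong (t *_) e ⟩
      t * (c * d) ≡⟨ solve 3 (λ t c d → t :* (c :* d) := c :* (t :* d)) refl t c d ⟩
      c * (t * d) ∎
      where open ≡-Reasoning

  1≢0 : 1# ≢ 0#
  1≢0 = 0≢1 ∘ sym

  x*1≡1*y⇒x≡y : ∀ {x y} → x * 1# ≡ 1# * y → x ≡ y
  x*1≡1*y⇒x≡y {x} {y} e =
    trans (sym (*-identityʳ x)) (trans e (*-identityˡ y))

  1*1≢x*0 : ∀ x → 1# * 1# ≢ x * 0#
  1*1≢x*0 x e = 1≢0 (trans (sym (*-identityˡ 1#)) (trans e (zeroʳ x)))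

  1*1≢0*x : ∀ x → 1# * 1# ≢ 0# * x
  1*1≢0*x x e = 1≢0 (trans (sym (*-identityˡ 1#)) (trans e (zeroˡ x)))

  coords-∥⇒≡ : ∀ X Y → coords X ∥ coords Y → X ≡ Y
  coords-∥⇒≡ (p1 b c) (p1 b′ c′) (_ , e₂ , e₃) = cong₂ p1 (x*1≡1*y⇒x≡y (sym e₃)) (x*1≡1*y⇒x≡y e₂)
  coords-∥⇒≡ (p1 b c) (p2 c′)    (_ , _ , e₃)  = ⊥-elim (1*1≢x*0 b e₃)
  coords-∥⇒≡ (p1 b c) p3         (_ , e₂ , _)  = ⊥-elim (1*1≢x*0 c (sym e₂))
  coords-∥⇒≡ (p2 c)   (p1 b′ c′) (_ , _ , e₃)  = ⊥-elim (1*1≢0*x b′ (sym e₃))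
  coords-∥⇒≡ (p2 c)   (p2 c′)    (e₁ , _ , _)  = cong p2 (x*1≡1*y⇒x≡y (sym e₁))
  coords-∥⇒≡ (p2 c)   p3         (e₁ , _ , _)  = ⊥-elim (1*1≢x*0 c e₁)
  coords-∥⇒≡ p3       (p1 b c)   (_ , e₂ , _)  = ⊥-elim (1*1≢0*x c e₂)
  coords-∥⇒≡ p3       (p2 c)     (e₁ , _ , _)  = ⊥-elim (1*1≢0*x c (sym e₁))
  coords-∥⇒≡ p3       p3         _             = refl

  normalise : (v : Vec3) → ¬ IsNull v → Σ Point λ X → Σ F λ t → coords X ≡ scale t v
  normalise (v₁ , v₂ , v₃) v≢0 with v₁ ≟ 0#
  ... | no v₁≢0 with inverse v₁ v₁≢0
  ...   | (t , v₁t≡1) = p1 (t * v₂) (t * v₃) , t , cong (_, t * v₂ , t * v₃) (sym (trans (*-comm t v₁) v₁t≡1))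
  normalise (v₁ , v₂ , v₃) v≢0 | yes v₁≡0 with v₂ ≟ 0#
  ... | no v₂≢0 with inverse v₂ v₂≢0
  ...   | (t , v₂t≡1) =
    p2 (t * v₃) , t , cong₂ _,_ (sym (t*≡0 v₁≡0)) (cong (_, t * v₃) (sym (trans (*-comm t v₂) v₂t≡1)))
  normalise (v₁ , v₂ , v₃) v≢0 | yes v₁≡0 | yes v₂≡0 with v₃ ≟ 0#
  ... | yes v₃≡0 = ⊥-elim (v≢0 (v₁≡0 , v₂≡0 , v₃≡0))
  ... | no v₃≢0 with inverse v₃ v₃≢0
  ...   | (t , v₃t≡1) =
    p3 , t , cong₂ _,_ (sym (t*≡0 v₁≡0)) (cong₂ _,_ (sym (t*≡0 v₂≡0)) (sym (trans (*-comm t v₃) v₃t≡1)))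

  affine-root : ∀ α β → β ≢ 0# → Σ F λ z → α + β * z ≡ 0#
  affine-root α β β≢0 with inverse β β≢0
  ... | γ , βγ≡1 = -1# * (α * γ) , (begin
    α + β * (-1# * (α * γ))   ≡⟨ solve 4 (λ a b m g → a :+ b :* (m :* (a :* g)) := a :+ m :* a :* (b :* g)) refl α β -1# γ ⟩
    α + -1# * α * (β * γ)     ≡⟨ cong (λ t → α + -1# * α * t) βγ≡1 ⟩
    α + -1# * α * 1#          ≡⟨ solve 2 (λ a m → a :+ m :* a :* con 1 := (con 1 :+ m) :* a) refl α -1# ⟩
    (1# + -1#) * α            ≡⟨ cancel-1 α ⟩
    0#                        ∎)
    where open ≡-Reasoning

  *-cancelˡ : ∀ β {z z′} → β ≢ 0# → β * z ≡ β * z′ → z ≡ z′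
  *-cancelˡ β {z} {z′} β≢0 βz≡βz′ with inverse β β≢0
  ... | γ , βγ≡1 = begin
    z              ≡⟨ *-identityˡ z ⟨
    1# * z         ≡⟨ cong (_* z) βγ≡1 ⟨
    β * γ * z      ≡⟨ solve 3 (λ b g z → b :* g :* z := g :* (b :* z)) refl β γ z ⟩
    γ * (β * z)    ≡⟨ cong (γ *_) βz≡βz′ ⟩
    γ * (β * z′)   ≡⟨ solve 3 (λ b g z → g :* (b :* z) := b :* g :* z) refl β γ z′ ⟩
    β * γ * z′     ≡⟨ cong (_* z′) βγ≡1 ⟩
    1# * z′        ≡⟨ *-identityˡ z′ ⟩
    z′             ∎
    where open ≡-Reasoning

  affine-root-unique : ∀ α β {z z′} → β ≢ 0# → α + β * z ≡ 0# → α + β * z′ ≡ 0# → z ≡ z′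
  affine-root-unique α β {z} {z′} β≢0 root root′ = *-cancelˡ β β≢0 (begin
    β * z                     ≡⟨ +-identityʳ (β * z) ⟨
    β * z + 0#                ≡⟨ cong (β * z +_) root′ ⟨
    β * z + (α + β * z′)      ≡⟨ solve 4 (λ a b z z′ → b :* z :+ (a :+ b :* z′) := a :+ b :* z :+ b :* z′) refl α β z z′ ⟩
    α + β * z + β * z′        ≡⟨ cong (_+ β * z′) root ⟩
    0# + β * z′               ≡⟨ +-identityˡ (β * z′) ⟩
    β * z′                    ∎)
    where open ≡-Reasoning

  incident⇒dot≡0 : ∀ X m → incident X m ≡ true → dot (coords m) (coords X) ≡ 0#
  incident⇒dot≡0 X m X∈m with dot (coords m) (coords X) ≟ 0#
  ... | yes m⊥X = m⊥X

  dot≡0⇒incident : ∀ X m → dot (coords m) (coords X) ≡ 0# → incident X m ≡ true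
  dot≡0⇒incident X m m⊥X with dot (coords m) (coords X) ≟ 0#
  ... | yes _   = refl
  ... | no m⊥̸X = ⊥-elim (m⊥̸X m⊥X)

  incident-sym : ∀ X m → incident X m ≡ incident m X
  incident-sym X m = cong (λ d → does (d ≟ 0#)) (dot-comm (coords m) (coords X))

  coords-non-null : ∀ X → ¬ IsNull (coords X)
  coords-non-null (p1 _ _) (1≡0 , _)     = 1≢0 1≡0
  coords-non-null (p2 _)   (_ , 1≡0 , _) = 1≢0 1≡0
  coords-non-null p3       (_ , _ , 1≡0) = 1≢0 1≡0

  cross-non-null : ∀ {X Y} → X ≢ Y → ¬ IsNull (cross (coords X) (coords Y))
  cross-non-null {X} {Y} X≢Y null = X≢Y (coords-∥⇒≡ X Y (null-cross⇒∥ _ _ null))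

  -- Opaque: otherwise later unification problems unfold the normalisation inside join and blow up.
  opaque
    join : (X Y : Point) → X ≢ Y → Line
    join X Y X≢Y = proj₁ (normalise (cross (coords X) (coords Y)) (cross-non-null X≢Y))

    on-join : ∀ X Y X≢Y Z → dot (cross (coords X) (coords Y)) (coords Z) ≡ 0# → incident Z (join X Y X≢Y) ≡ true
    on-join X Y X≢Y Z n⊥Z with normalise (cross (coords X) (coords Y)) (cross-non-null X≢Y)
    ... | (m , t , m≡tn) =
      dot≡0⇒incident Z m (trans (cong (λ w → dot w (coords Z)) m≡tn) (trans (dot-scaleˡ t _ _) (t*≡0 n⊥Z)))

    join-unique : ∀ X Y X≢Y m → incident X m ≡ true → incident Y m ≡ true → m ≡ join X Y X≢Y
    join-unique X Y X≢Y m X∈m Y∈m with normalise (cross (coords X) (coords Y)) (cross-non-null X≢Y)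
    ... | (n , t , n≡tc) = coords-∥⇒≡ m n (subst (coords m ∥_) (sym n≡tc)
            (∥-scaleʳ _ _ t (dot≡0⇒∥-cross (coords m) (coords X) (coords Y)
              (incident⇒dot≡0 X m X∈m) (incident⇒dot≡0 Y m Y∈m))))

  join-incidentˡ : ∀ X Y X≢Y → incident X (join X Y X≢Y) ≡ true
  join-incidentˡ X Y X≢Y = on-join X Y X≢Y X (dot-crossˡ (coords X) (coords Y))

  join-incidentʳ : ∀ X Y X≢Y → incident Y (join X Y X≢Y) ≡ true
  join-incidentʳ X Y X≢Y = on-join X Y X≢Y Y (dot-crossʳ (coords X) (coords Y))

module Incidence (K : FiniteField) where
  open import Data.Bool using (true; false)
  open import Relation.Nullary using (¬_; Dec; yes; no)
  open import Relation.Binary.PropositionalEquality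
  open PG2 K using (Point; Line; incident)
  open Coordinates K using (join; join-incidentˡ; join-incidentʳ; join-unique; incident-sym)

  infix 4 _∈ₗ_ _∉ₗ_ _∈ₗ?_

  record _∈ₗ_ (X : Point) (m : Line) : Set where
    constructor on
    field incident≡true : incident X m ≡ true

  open _∈ₗ_ public

  _∉ₗ_ : Point → Line → Set
  X ∉ₗ m = ¬ X ∈ₗ m

  ∉ₗ-from-false : ∀ {X m} → incident X m ≡ false → X ∉ₗ m
  ∉ₗ-from-false X∉m (on X∈m) with trans (sym X∈m) X∉m
  ... | ()

  _∈ₗ?_ : ∀ X m → Dec (X ∈ₗ m)
  X ∈ₗ? m with incident X m in X∈m
  ... | true  = yes (on X∈m)
  ... | false = no (∉ₗ-from-false X∈m)

  ∈ₗ-dual : ∀ {X m} → X ∈ₗ m → m ∈ₗ X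
  ∈ₗ-dual {X} {m} (on X∈m) = on (trans (sym (incident-sym X m)) X∈m)

  ∈-∉⇒≢ : ∀ {X Y m} → X ∈ₗ m → Y ∉ₗ m → X ≢ Y
  ∈-∉⇒≢ X∈m Y∉m refl = Y∉m X∈m

  ∈-∉⇒≢ₗ : ∀ {X m n} → X ∈ₗ m → X ∉ₗ n → m ≢ n
  ∈-∉⇒≢ₗ X∈m X∉n refl = X∉n X∈m

  line-unique : ∀ {X Y m n} → X ≢ Y → X ∈ₗ m → Y ∈ₗ m → X ∈ₗ n → Y ∈ₗ n → m ≡ n
  line-unique {X} {Y} {m} {n} X≢Y (on X∈m) (on Y∈m) (on X∈n) (on Y∈n) =
    trans (join-unique X Y X≢Y m X∈m Y∈m) (sym (join-unique X Y X≢Y n X∈n Y∈n))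

  point-unique : ∀ {X Y m n} → m ≢ n → X ∈ₗ m → X ∈ₗ n → Y ∈ₗ m → Y ∈ₗ n → X ≡ Y
  point-unique m≢n X∈m X∈n Y∈m Y∈n =
    line-unique m≢n (∈ₗ-dual X∈m) (∈ₗ-dual X∈n) (∈ₗ-dual Y∈m) (∈ₗ-dual Y∈n)

  line : (X Y : Point) → X ≢ Y → Line
  line = join

  line-∈ˡ : ∀ {X Y} (X≢Y : X ≢ Y) → X ∈ₗ line X Y X≢Y
  line-∈ˡ X≢Y = on (join-incidentˡ _ _ X≢Y)

  line-∈ʳ : ∀ {X Y} (X≢Y : X ≢ Y) → Y ∈ₗ line X Y X≢Y
  line-∈ʳ X≢Y = on (join-incidentʳ _ _ X≢Y)

  meet-point : (m n : Line) → m ≢ n → Point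
  meet-point = join

  meet-point-∈ˡ : ∀ {m n} (m≢n : m ≢ n) → meet-point m n m≢n ∈ₗ m
  meet-point-∈ˡ m≢n = ∈ₗ-dual (on (join-incidentˡ _ _ m≢n))

  meet-point-∈ʳ : ∀ {m n} (m≢n : m ≢ n) → meet-point m n m≢n ∈ₗ n
  meet-point-∈ʳ m≢n = ∈ₗ-dual (on (join-incidentʳ _ _ m≢n))

module PointCounting (K : FiniteField) where
  open import Function using (_∘_)
  open import Data.Nat using (ℕ; suc; _+_; _≤_; _<_; z≤n; s≤s)
  open import Data.Nat.Properties using (+-identityʳ; +-mono-≤; ≤-reflexive; +-cancelˡ-<; module ≤-Reasoning)
  open import Data.Nat.ListAction using (sum)
  open import Data.Bool using (Bool; true; false; _∧_; _∨_; not)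
  open import Data.Bool.Properties using (∧-zeroʳ; not-¬)
  open import Data.Sum using (_⊎_; inj₁; inj₂)
  open import Data.Empty using (⊥; ⊥-elim)
  open import Data.List using (List; []; _∷_; _++_; map; concatMap; length)
  open import Data.List.Properties using (map-∘; map-cong; map-cong-local)
  open import Data.List.Membership.Propositional using (_∈_; lose)
  open import Data.List.Membership.Propositional.Properties using (∈-++⁺ˡ; ∈-++⁺ʳ; ∈-map⁺; ∈-concatMap⁺)
  open import Data.List.Relation.Unary.Any using (here)
  open import Data.List.Relation.Unary.All as All using (All)
  open import Data.List.Relation.Unary.Unique.Propositional using (Unique)
  open import Data.Product using (∃; _×_; _,_; proj₁; proj₂)
  open import Relation.Nullary using (does; yes; no)
  open import Relation.Nullary.Decidable using (map′; _×-dec_; dec-true; dec-false)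
  open import Relation.Binary.Definitions using (DecidableEquality)
  open import Relation.Binary.PropositionalEquality hiding ([_])
  open FiniteField K using (F; elements; complete; unique; _≟_)
  open PG2 K
  open Booleans using ([_]; ∧≡true; not≡true; does≡true⇒)
  open ListSums

  _≟ᴾ_ : DecidableEquality Point
  p1 a b ≟ᴾ p1 c d = map′ (λ (a≡c , b≡d) → cong₂ p1 a≡c b≡d) (λ { refl → refl , refl }) ((a ≟ c) ×-dec (b ≟ d))
  p2 a   ≟ᴾ p2 c   = map′ (cong p2) (λ { refl → refl }) (a ≟ c)
  p3     ≟ᴾ p3     = yes refl
  p1 _ _ ≟ᴾ p2 _   = no λ ()
  p1 _ _ ≟ᴾ p3     = no λ ()
  p2 _   ≟ᴾ p1 _ _ = no λ ()
  p2 _   ≟ᴾ p3     = no λ ()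
  p3     ≟ᴾ p1 _ _ = no λ ()
  p3     ≟ᴾ p2 _   = no λ ()

  does-≟ᴾ : ∀ X Y → does (X ≟ᴾ Y) ≡ (X == Y)
  does-≟ᴾ (p1 _ _) (p1 _ _) = refl
  does-≟ᴾ (p1 _ _) (p2 _)   = refl
  does-≟ᴾ (p1 _ _) p3       = refl
  does-≟ᴾ (p2 _)   (p1 _ _) = refl
  does-≟ᴾ (p2 _)   (p2 _)   = refl
  does-≟ᴾ (p2 _)   p3       = refl
  does-≟ᴾ p3       (p1 _ _) = refl
  does-≟ᴾ p3       (p2 _)   = refl
  does-≟ᴾ p3       p3       = refl

  ==⇒≡ : ∀ X Y → (X == Y) ≡ true → X ≡ Y
  ==⇒≡ X Y X==Y = does≡true⇒ (X ≟ᴾ Y) (trans (does-≟ᴾ X Y) X==Y)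

  ==-refl : ∀ X → (X == X) ≡ true
  ==-refl X = trans (sym (does-≟ᴾ X X)) (dec-true (X ≟ᴾ X) refl)

  ==-false⇒≢ : ∀ X Y → (X == Y) ≡ false → X ≢ Y
  ==-false⇒≢ X _ X≠Y refl = not-¬ (==-refl X) X≠Y

  ≢⇒==-false : ∀ {X Y} → X ≢ Y → (X == Y) ≡ false
  ≢⇒==-false {X} {Y} X≢Y = trans (sym (does-≟ᴾ X Y)) (dec-false (X ≟ᴾ Y) X≢Y)

  affinePoints : List Point
  affinePoints = concatMap (λ y → map (p1 y) elements) elements

  allPoints-complete : ∀ X → X ∈ allPoints
  allPoints-complete (p1 y z) = ∈-++⁺ˡ (∈-concatMap⁺ _ (lose (complete y) (∈-map⁺ (p1 y) (complete z))))
  allPoints-complete (p2 z)   = ∈-++⁺ʳ affinePoints (∈-++⁺ˡ (∈-map⁺ p2 (complete z)))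
  allPoints-complete p3       = ∈-++⁺ʳ affinePoints (∈-++⁺ʳ (map p2 elements) (here refl))

  affineSum : (Point → ℕ) → ℕ
  affineSum h = sum (map (λ y → sum (map (λ z → h (p1 y z)) elements)) elements)

  sum-allPoints : (h : Point → ℕ) → sum (map h allPoints) ≡ affineSum h + (sum (map (h ∘ p2) elements) + (h p3 + 0))
  sum-allPoints h = begin
    sum (map h allPoints)
      ≡⟨ sum-map-++ h affinePoints _ ⟩
    sum (map h affinePoints) + sum (map h (map p2 elements ++ p3 ∷ []))
      ≡⟨ cong₂ _+_ (sum-map-concatMap h _ elements) (sum-map-++ h (map p2 elements) _) ⟩
    sum (map (λ y → sum (map h (map (p1 y) elements))) elements) + (sum (map h (map p2 elements)) + (h p3 + 0))
      ≡⟨ cong₂ _+_ (cong sum (map-cong (λ y → cong sum (sym (map-∘ elements))) elements))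
                   (cong (_+ (h p3 + 0)) (cong sum (sym (map-∘ elements)))) ⟩
    affineSum h + (sum (map (h ∘ p2) elements) + (h p3 + 0)) ∎
    where open ≡-Reasoning

  sum-elements-single : (f : F → ℕ) (b : F) → (∀ x → x ≢ b → f x ≡ 0) → sum (map f elements) ≡ f b
  sum-elements-single f b = sum-map-single f unique (complete b)

  sum-elements-zero : (f : F → ℕ) → (∀ x → f x ≡ 0) → sum (map f elements) ≡ 0
  sum-elements-zero f f≡0 = sum-map-zero (All.universal f≡0 elements)

  sum-allPoints-single : (h : Point → ℕ) (B : Point) → (∀ X → X ≢ B → h X ≡ 0) → sum (map h allPoints) ≡ h B
  sum-allPoints-single h (p1 a b) vanish = trans (sum-allPoints h) (trans (cong₂ _+_ affine rest) (+-identityʳ _))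
    where
    affine : affineSum h ≡ h (p1 a b)
    affine = trans (sum-elements-single _ a (λ y y≢a → sum-elements-zero _ (λ z → vanish (p1 y z) λ { refl → y≢a refl })))
                   (sum-elements-single _ b (λ z z≢b → vanish (p1 a z) λ { refl → z≢b refl }))
    rest : sum (map (h ∘ p2) elements) + (h p3 + 0) ≡ 0
    rest = cong₂ _+_ (sum-elements-zero _ (λ z → vanish (p2 z) λ ())) (cong (_+ 0) (vanish p3 λ ()))
  sum-allPoints-single h (p2 c) vanish = trans (sum-allPoints h) (trans (cong₂ _+_ affine rest) (+-identityʳ _))
    where
    affine : affineSum h ≡ 0
    affine = sum-elements-zero _ (λ y → sum-elements-zero _ (λ z → vanish (p1 y z) λ ()))
    rest : sum (map (h ∘ p2) elements) + (h p3 + 0) ≡ h (p2 c) + 0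
    rest = cong₂ _+_ (sum-elements-single _ c (λ z z≢c → vanish (p2 z) λ { refl → z≢c refl })) (cong (_+ 0) (vanish p3 λ ()))
  sum-allPoints-single h p3 vanish = trans (sum-allPoints h) (trans (cong₂ _+_ affine rest) (+-identityʳ _))
    where
    affine : affineSum h ≡ 0
    affine = sum-elements-zero _ (λ y → sum-elements-zero _ (λ z → vanish (p1 y z) λ ()))
    rest : sum (map (h ∘ p2) elements) + (h p3 + 0) ≡ h p3 + 0
    rest = cong (_+ (h p3 + 0)) (sum-elements-zero _ (λ z → vanish (p2 z) λ ()))

  count-as-sum : (f : Point → Bool) → count f ≡ sum (map (λ X → [ f X ]) allPoints)
  count-as-sum f = length-filter≡sum f allPoints

  count-cong : {f g : Point → Bool} → (∀ X → f X ≡ g X) → count f ≡ count g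
  count-cong {f} {g} f≗g =
    trans (count-as-sum f) (trans (cong sum (map-cong (cong [_] ∘ f≗g) allPoints)) (sym (count-as-sum g)))

  count-mono : {f g : Point → Bool} → (∀ X → f X ≡ true → g X ≡ true) → count f ≤ count g
  count-mono {f} {g} f⇒g = subst₂ _≤_ (sym (count-as-sum f)) (sym (count-as-sum g)) (sum-map-mono pointwise allPoints)
    where
    pointwise : ∀ X → [ f X ] ≤ [ g X ]
    pointwise X with f X in fX
    ... | true  = ≤-reflexive (cong [_] (sym (f⇒g X fX)))
    ... | false = z≤n

  count-∨ : (f g : Point → Bool) → (∀ X → f X ≡ true → g X ≡ true → ⊥) →
    count (λ X → f X ∨ g X) ≡ count f + count g
  count-∨ f g disjoint = begin
    count (λ X → f X ∨ g X)                              ≡⟨ count-as-sum _ ⟩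
    sum (map (λ X → [ f X ∨ g X ]) allPoints)            ≡⟨ cong sum (map-cong pointwise allPoints) ⟩
    sum (map (λ X → [ f X ] + [ g X ]) allPoints)        ≡⟨ sum-map-+ _ _ allPoints ⟩
    sum (map (λ X → [ f X ]) allPoints) + sum (map (λ X → [ g X ]) allPoints)
                                                          ≡⟨ cong₂ _+_ (count-as-sum f) (count-as-sum g) ⟨
    count f + count g                                     ∎
    where
    open ≡-Reasoning
    pointwise : ∀ X → [ f X ∨ g X ] ≡ [ f X ] + [ g X ]
    pointwise X with f X in fX | g X in gX
    ... | true  | true  = ⊥-elim (disjoint X fX gX)
    ... | true  | false = refl
    ... | false | _     = refl

  count-split : (f g : Point → Bool) → count f ≡ count (λ X → f X ∧ g X) + count (λ X → f X ∧ not (g X))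
  count-split f g = trans (count-cong pointwise) (count-∨ _ _ disjoint)
    where
    pointwise : ∀ X → f X ≡ (f X ∧ g X) ∨ (f X ∧ not (g X))
    pointwise X with f X | g X
    ... | true  | true  = refl
    ... | true  | false = refl
    ... | false | _     = refl
    disjoint : ∀ X → (f X ∧ g X) ≡ true → (f X ∧ not (g X)) ≡ true → ⊥
    disjoint X with f X | g X
    ... | true | true  = λ _ ()
    ... | true | false = λ ()

  count-== : ∀ B → count (_== B) ≡ 1
  count-== B = trans (count-as-sum _)
    (trans (sum-allPoints-single _ B (λ X X≢B → cong [_] (≢⇒==-false X≢B))) (cong [_] (==-refl B)))

  count-remove : (f : Point → Bool) (B : Point) → f B ≡ true → count f ≡ suc (count (λ X → f X ∧ not (X == B)))
  count-remove f B fB =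
    trans (count-split f (_== B)) (cong (_+ count (λ X → f X ∧ not (X == B))) (trans (count-cong pointwise) (count-== B)))
    where
    pointwise : ∀ X → (f X ∧ (X == B)) ≡ (X == B)
    pointwise X with X == B in X==B
    ... | true  = cong (_∧ true) (subst (λ Y → f Y ≡ true) (sym (==⇒≡ X B X==B)) fB)
    ... | false = ∧-zeroʳ (f X)

  count-≤1 : (f : Point → Bool) (B : Point) → (∀ X → f X ≡ true → X ≡ B) → count f ≤ 1
  count-≤1 f B only-B = subst (_≤ 1) (sym (trans (count-as-sum f) (sum-allPoints-single _ B vanish))) (indicator≤1 (f B))
    where
    indicator≤1 : ∀ b → [ b ] ≤ 1
    indicator≤1 true  = s≤s z≤n
    indicator≤1 false = z≤n
    vanish : ∀ X → X ≢ B → [ f X ] ≡ 0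
    vanish X X≢B with f X in fX
    ... | true  = ⊥-elim (X≢B (only-B X fX))
    ... | false = refl

  count-≤2 : (f : Point → Bool) (B C : Point) → (∀ X → f X ≡ true → X ≡ B ⊎ X ≡ C) → count f ≤ 2
  count-≤2 f B C only-B-C = subst (_≤ 2) (sym (count-split f (_== B))) (+-mono-≤ (count-≤1 _ B at-B) (count-≤1 _ C at-C))
    where
    at-B : ∀ X → (f X ∧ (X == B)) ≡ true → X ≡ B
    at-B X fX∧X==B = ==⇒≡ X B (proj₂ (∧≡true fX∧X==B))
    at-C : ∀ X → (f X ∧ not (X == B)) ≡ true → X ≡ C
    at-C X fX∧X≠B with ∧≡true fX∧X≠B
    ... | fX , X≠B with only-B-C X fX
    ...   | inj₂ X≡C = X≡C
    ...   | inj₁ refl with trans (sym (==-refl X)) (not≡true X≠B)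
    ...     | ()

  count-≥ : (f : Point → Bool) {bs : List Point} → Unique bs → All (λ b → f b ≡ true) bs → length bs ≤ count f
  count-≥ f {bs} bs! f-bs = begin
    length bs                             ≡⟨ sum-map-const-1 bs ⟨
    sum (map (λ _ → 1) bs)                ≡⟨ cong sum (map-cong-local (All.map (λ fb → cong [_] (sym fb)) f-bs)) ⟩
    sum (map (λ X → [ f X ]) bs)          ≤⟨ sum-map-≥-unique _≟ᴾ_ _ allPoints bs! (λ {b} _ → allPoints-complete b) ⟩
    sum (map (λ X → [ f X ]) allPoints)   ≡⟨ count-as-sum f ⟨
    count f                               ∎
    where open ≤-Reasoning

  count-positive : (f : Point → Bool) → 0 < count f → ∃ λ X → f X ≡ true
  count-positive f 0<count with sum-map-positive _ allPoints (subst (0 <_) (count-as-sum f) 0<count)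
  ... | X , 0<[fX] = X , indicator-positive 0<[fX]
    where
    indicator-positive : ∀ {b} → 0 < [ b ] → b ≡ true
    indicator-positive {true} _ = refl

  ⊂-witness : {f g : Point → Bool} → (∀ X → g X ≡ true → f X ≡ true) → count g < count f →
    ∃ λ Y → f Y ≡ true × g Y ≡ false
  ⊂-witness {f} {g} g⇒f count-g<count-f with count-positive _ missing-positive
    where
    common : count (λ X → f X ∧ g X) ≡ count g
    common = count-cong pointwise
      where
      pointwise : ∀ X → (f X ∧ g X) ≡ g X
      pointwise X with g X in gX
      ... | true  = trans (cong (_∧ true) (g⇒f X gX)) refl
      ... | false = ∧-zeroʳ (f X)
    missing-positive : 0 < count (λ X → f X ∧ not (g X))
    missing-positive = +-cancelˡ-< (count g) 0 (count (λ X → f X ∧ not (g X)))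
      (subst₂ _<_ (sym (+-identityʳ (count g)))
        (trans (count-split f g) (cong (_+ count (λ X → f X ∧ not (g X))) common)) count-g<count-f)
  ... | Y , fY∧¬gY = Y , proj₁ (∧≡true fY∧¬gY) , not≡true (proj₂ (∧≡true fY∧¬gY))

module LineSize (K : FiniteField) where
  open import Data.Nat as ℕ using (ℕ; suc)
  open import Data.Nat.Properties using (+-comm)
  open import Data.Nat.ListAction using (sum)
  open import Data.Bool using (Bool; if_then_else_)
  open import Data.List using (map)
  open import Data.List.Properties using (map-cong)
  open import Data.Product using (_,_)
  open import Relation.Nullary using (¬_; does; yes; no)
  open import Relation.Nullary.Decidable using (dec-true; dec-false)
  open import Relation.Binary.PropositionalEquality hiding ([_])
  open FiniteField K using (F; elements; _≟_; order)
  open PG2 K using (Point; Line; p2; p3; coords; incident; count)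
  open Booleans using ([_])
  open ListSums using (sum-map-const-1)
  open PointCounting K using (affineSum; count-as-sum; sum-allPoints; sum-elements-single; sum-elements-zero)
  open Coordinates K using (ring; Vec3; IsNull; dot; coords-non-null; affine-root; affine-root-unique)
  open import Algebra.Bundles using (CommutativeRing)
  open CommutativeRing ring using (_+_; _*_; 0#; 1#; commutativeSemiring)
  open import Algebra.Solver.Ring.NaturalCoefficients.Default commutativeSemiring
    using (solve; _:=_; _:+_; _:*_; con)

  zero-test : F → ℕ
  zero-test x = [ does (x ≟ 0#) ]

  zero-test-0 : ∀ {x} → x ≡ 0# → zero-test x ≡ 1
  zero-test-0 {x} x≡0 = cong [_] (dec-true (x ≟ 0#) x≡0)

  zero-test-≢0 : ∀ {x} → x ≢ 0# → zero-test x ≡ 0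
  zero-test-≢0 {x} x≢0 = cong [_] (dec-false (x ≟ 0#) x≢0)

  all-roots : (e : F → F) → (∀ z → e z ≡ 0#) → sum (map (λ z → zero-test (e z)) elements) ≡ order
  all-roots e e≡0 = trans (cong sum (map-cong (λ z → zero-test-0 (e≡0 z)) elements)) (sum-map-const-1 elements)

  no-roots : (e : F → F) → (∀ z → e z ≢ 0#) → sum (map (λ z → zero-test (e z)) elements) ≡ 0
  no-roots e e≢0 = sum-elements-zero _ (λ z → zero-test-≢0 (e≢0 z))

  affine-count : ∀ α β → β ≢ 0# → sum (map (λ z → zero-test (α + β * z)) elements) ≡ 1
  affine-count α β β≢0 with affine-root α β β≢0
  ... | z₀ , root = trans (sum-elements-single _ z₀ non-root) (zero-test-0 root)
    where
    non-root : ∀ z → z ≢ z₀ → zero-test (α + β * z) ≡ 0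
    non-root z z≢z₀ = zero-test-≢0 (λ root′ → z≢z₀ (affine-root-unique α β β≢0 root′ root))

  count-by-parts : (f : Point → Bool) {i j k : ℕ} → affineSum (λ X → [ f X ]) ≡ i →
    sum (map (λ z → [ f (p2 z) ]) elements) ≡ j → [ f p3 ] ≡ k → count f ≡ i ℕ.+ (j ℕ.+ (k ℕ.+ 0))
  count-by-parts f affine-part p2-part p3-part =
    trans (count-as-sum f) (trans (sum-allPoints _) (cong₂ ℕ._+_ affine-part (cong₂ ℕ._+_ p2-part (cong (ℕ._+ 0) p3-part))))

  count-dot≡0 : (n : Vec3) → ¬ IsNull n → count (λ X → does (dot n (coords X) ≟ 0#)) ≡ suc order
  count-dot≡0 (a , b , c) n≢0 with c ≟ 0# | b ≟ 0#
  ... | no c≢0 | _ = trans (count-by-parts _ rows (affine-count (a * 0# + b * 1#) c c≢0) p3-part) (+-comm order 1)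
    where
    rows : affineSum (λ X → zero-test (dot (a , b , c) (coords X))) ≡ order
    rows = trans (cong sum (map-cong (λ y → affine-count (a * 1# + b * y) c c≢0) elements)) (sum-map-const-1 elements)
    p3-part : zero-test (a * 0# + b * 0# + c * 1#) ≡ 0
    p3-part = zero-test-≢0 λ e → c≢0 (trans (solve 3 (λ a b c → c := a :* con 0 :+ b :* con 0 :+ c :* con 1) refl a b c) e)
  ... | yes refl | no b≢0 = trans (count-by-parts _ rows (no-roots _ p2-part) (zero-test-0 p3-part)) (+-comm order 1)
    where
    drop-z : ∀ y z → a * 1# + b * y + 0# * z ≡ a * 1# + b * y
    drop-z y z = solve 4 (λ a b y z → a :* con 1 :+ b :* y :+ con 0 :* z := a :* con 1 :+ b :* y) refl a b y z
    row : F → ℕ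
    row y = if does ((a * 1# + b * y) ≟ 0#) then order else 0
    row≡ : ∀ y → sum (map (λ z → zero-test (a * 1# + b * y + 0# * z)) elements) ≡ row y
    row≡ y with (a * 1# + b * y) ≟ 0#
    ... | yes root = all-roots _ (λ z → trans (drop-z y z) root)
    ... | no ¬root = no-roots _ (λ z e → ¬root (trans (sym (drop-z y z)) e))
    rows : affineSum (λ X → zero-test (dot (a , b , 0#) (coords X))) ≡ order
    rows with affine-root (a * 1#) b b≢0
    ... | y₀ , root = trans (cong sum (map-cong row≡ elements)) (trans (sum-elements-single row y₀ non-root) at-root)
      where
      non-root : ∀ y → y ≢ y₀ → row y ≡ 0
      non-root y y≢y₀
        rewrite dec-false ((a * 1# + b * y) ≟ 0#) (λ root′ → y≢y₀ (affine-root-unique (a * 1#) b b≢0 root′ root))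
        = refl
      at-root : row y₀ ≡ order
      at-root rewrite dec-true ((a * 1# + b * y₀) ≟ 0#) root = refl
    p2-part : ∀ z → a * 0# + b * 1# + 0# * z ≢ 0#
    p2-part z e = b≢0 (trans (solve 3 (λ a b z → b := a :* con 0 :+ b :* con 1 :+ con 0 :* z) refl a b z) e)
    p3-part : a * 0# + b * 0# + 0# * 1# ≡ 0#
    p3-part = solve 2 (λ a b → a :* con 0 :+ b :* con 0 :+ con 0 :* con 1 := con 0) refl a b
  ... | yes refl | yes refl = trans (count-by-parts _ rows (all-roots _ p2-part) (zero-test-0 p3-part)) (+-comm order 1)
    where
    a≢0 : a ≢ 0#
    a≢0 a≡0 = n≢0 (a≡0 , refl , refl)
    rows : affineSum (λ X → zero-test (dot (a , 0# , 0#) (coords X))) ≡ 0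
    rows = sum-elements-zero _ (λ y → no-roots _ (λ z e →
      a≢0 (trans (solve 3 (λ a y z → a := a :* con 1 :+ con 0 :* y :+ con 0 :* z) refl a y z) e)))
    p2-part : ∀ z → a * 0# + 0# * 1# + 0# * z ≡ 0#
    p2-part = solve 2 (λ a z → a :* con 0 :+ con 0 :* con 1 :+ con 0 :* z := con 0) refl a
    p3-part : a * 0# + 0# * 0# + 0# * 1# ≡ 0#
    p3-part = solve 1 (λ a → a :* con 0 :+ con 0 :* con 0 :+ con 0 :* con 1 := con 0) refl a

  points-on-line : (m : Line) → count (λ X → incident X m) ≡ suc order
  points-on-line m = count-dot≡0 (coords m) (coords-non-null m)

module Binomial where
  open import Data.Nat using (zero; suc; _+_; _≤_; z≤n; s≤s)
  open import Data.Nat.Properties using (+-mono-≤)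
  open import Data.Nat.Combinatorics using (_C_; nCk+nC[k+1]≡[n+1]C[k+1]; nC1≡n)
  open import Relation.Binary.PropositionalEquality

  suc-C-2 : ∀ n → suc n C 2 ≡ n + n C 2
  suc-C-2 n = trans (sym (nCk+nC[k+1]≡[n+1]C[k+1] n 1)) (cong (_+ n C 2) (nC1≡n n))

  C-2-mono : ∀ {m n} → m ≤ n → m C 2 ≤ n C 2
  C-2-mono {n = zero}  z≤n = z≤n
  C-2-mono {zero} {suc n} _ = z≤n
  C-2-mono {suc m} {suc n} (s≤s m≤n) = subst₂ _≤_ (sym (suc-C-2 m)) (sym (suc-C-2 n)) (+-mono-≤ m≤n (C-2-mono m≤n))

module SecantWeights (K : FiniteField) where
  open import Data.Nat using (ℕ; _+_; _≤_; z≤n; _≤?_)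
  open import Data.Nat.Properties
    using (≤-trans; ≤-pred; ≰⇒>; +-identityʳ; +-mono-≤; ≤-reflexive; n≤0⇒n≡0; module ≤-Reasoning)
  open import Data.Nat.ListAction using (sum)
  open import Data.Bool using (true; false; _∧_; if_then_else_)
  open import Data.List using (List; map; length)
  open import Data.List.Properties using (map-cong; map-cong-local)
  open import Data.List.Relation.Unary.All as All using (All; []; _∷_)
  open import Data.List.Relation.Unary.AllPairs using ([]; _∷_)
  open import Data.List.Relation.Unary.Unique.Propositional using (Unique)
  open import Data.Product using (_×_; _,_; proj₁; proj₂)
  open import Data.Sum using (_⊎_)
  open import Relation.Binary.PropositionalEquality hiding ([_])
  open PG2 K
  open Booleans using (∧≡true; does≡false⇒¬)
  open ListSums
  open PointCounting K
  open Incidence K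
  open Binomial

  meet-≥ : (A : PointSet) (m : Line) {bs : List Point} → Unique bs →
    All (λ Z → Z ∈ₗ m × A Z ≡ true) bs → length bs ≤ meet A m
  meet-≥ A m bs! on-m = count-≥ _ bs! (All.map (λ (on Z∈m , AZ) → cong₂ _∧_ Z∈m AZ) on-m)

  meet-≤1 : (A : PointSet) (m : Line) (B : Point) → (∀ Z → Z ∈ₗ m → A Z ≡ true → Z ≡ B) → meet A m ≤ 1
  meet-≤1 A m B only-B =
    count-≤1 _ B (λ Z Z∈m∩A → only-B Z (on (proj₁ (∧≡true Z∈m∩A))) (proj₂ (∧≡true Z∈m∩A)))

  meet-≤2 : (A : PointSet) (m : Line) (B₁ B₂ : Point) → (∀ Z → Z ∈ₗ m → A Z ≡ true → Z ≡ B₁ ⊎ Z ≡ B₂) →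
    meet A m ≤ 2
  meet-≤2 A m B₁ B₂ only-B₁-B₂ =
    count-≤2 _ B₁ B₂ (λ Z Z∈m∩A → only-B₁-B₂ Z (on (proj₁ (∧≡true Z∈m∩A))) (proj₂ (∧≡true Z∈m∩A)))

  meet-mono : {A B : PointSet} → B ⊆ A → (m : Line) → meet B m ≤ meet A m
  meet-mono B⊆A m =
    count-mono λ Z Z∈m∩B → cong₂ _∧_ (proj₁ (∧≡true Z∈m∩B)) (B⊆A Z (proj₂ (∧≡true Z∈m∩B)))

  lineWeight : PointSet → Point → Line → ℕ
  lineWeight A X m = if incident X m then multiplicity A m else 0

  secantWeight-as-sum : ∀ A X → secantWeight A X ≡ sum (map (lineWeight A X) allLines)
  secantWeight-as-sum A X = trans (sum-map-filter≡sum _ _ allLines) (cong sum (map-cong pointwise allLines))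
    where
    non-secant : ∀ m → isSecant A m ≡ false → multiplicity A m ≡ 0
    non-secant m not-secant =
      n≤0⇒n≡0 (C-2-mono (≤-pred (≰⇒> (does≡false⇒¬ (2 ≤? meet A m) not-secant))))
    pointwise : ∀ m → (if incident X m ∧ isSecant A m then multiplicity A m else 0) ≡ lineWeight A X m
    pointwise m with incident X m
    ... | false = refl
    ... | true  = drop-test (isSecant A m) (non-secant m)
      where
      drop-test : ∀ b → (b ≡ false → multiplicity A m ≡ 0) → (if b then multiplicity A m else 0) ≡ multiplicity A m
      drop-test true  _    = refl
      drop-test false vanishes = sym (vanishes refl)

  secantWeight-mono : {A B : PointSet} → B ⊆ A → ∀ X → secantWeight B X ≤ secantWeight A X
  secantWeight-mono {A} {B} B⊆A X =
    subst₂ _≤_ (sym (secantWeight-as-sum B X)) (sym (secantWeight-as-sum A X)) (sum-map-mono pointwise allLines)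
    where
    pointwise : ∀ m → lineWeight B X m ≤ lineWeight A X m
    pointwise m with incident X m
    ... | false = z≤n
    ... | true  = C-2-mono (meet-mono B⊆A m)

  secantWeight-≥ : (A : PointSet) (X : Point) {ms : List Line} → Unique ms → All (X ∈ₗ_) ms →
    sum (map (multiplicity A) ms) ≤ secantWeight A X
  secantWeight-≥ A X {ms} ms! X∈ms = begin
    sum (map (multiplicity A) ms)       ≡⟨ cong sum (map-cong-local (All.map through-X X∈ms)) ⟩
    sum (map (lineWeight A X) ms)       ≤⟨ sum-map-≥-unique _≟ᴾ_ _ allLines ms! (λ {m} _ → allPoints-complete m) ⟩
    sum (map (lineWeight A X) allLines) ≡⟨ secantWeight-as-sum A X ⟨
    secantWeight A X                    ∎
    where
    open ≤-Reasoning
    through-X : ∀ {m} → X ∈ₗ m → multiplicity A m ≡ lineWeight A X m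
    through-X (on X∈m) rewrite X∈m = refl

  secantWeight-≥-line : (A : PointSet) {X : Point} {n : Line} → X ∈ₗ n → multiplicity A n ≤ secantWeight A X
  secantWeight-≥-line A {X} {n} X∈n =
    ≤-trans (≤-reflexive (sym (+-identityʳ (multiplicity A n)))) (secantWeight-≥ A X ([] ∷ []) (X∈n ∷ []))

  secantWeight-≥-lines : (A : PointSet) {X : Point} {n₁ n₂ : Line} → n₁ ≢ n₂ → X ∈ₗ n₁ → X ∈ₗ n₂ →
    multiplicity A n₁ + multiplicity A n₂ ≤ secantWeight A X
  secantWeight-≥-lines A {X} {n₁} {n₂} n₁≢n₂ X∈n₁ X∈n₂ =
    ≤-trans (≤-reflexive (cong (multiplicity A n₁ +_) (sym (+-identityʳ (multiplicity A n₂)))))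
            (secantWeight-≥ A X ((n₁≢n₂ ∷ []) ∷ [] ∷ []) (X∈n₁ ∷ X∈n₂ ∷ []))

  secantWeight-≥-rich-line : (A : PointSet) {X : Point} {n : Line} → X ∈ₗ n → 3 ≤ meet A n →
    3 ≤ secantWeight A X
  secantWeight-≥-rich-line A X∈n rich = ≤-trans (C-2-mono rich) (secantWeight-≥-line A X∈n)

  secantWeight-≥-two-secants : (A : PointSet) {X : Point} {n₁ n₂ : Line} → n₁ ≢ n₂ → X ∈ₗ n₁ → X ∈ₗ n₂ →
    2 ≤ meet A n₁ → 2 ≤ meet A n₂ → 2 ≤ secantWeight A X
  secantWeight-≥-two-secants A n₁≢n₂ X∈n₁ X∈n₂ secant₁ secant₂ =
    ≤-trans (+-mono-≤ (C-2-mono secant₁) (C-2-mono secant₂)) (secantWeight-≥-lines A n₁≢n₂ X∈n₁ X∈n₂)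

  secantWeight-≤1 : (A : PointSet) (X : Point) (L : Line) → meet A L ≤ 2 →
    (∀ m → X ∈ₗ m → m ≢ L → meet A m ≤ 1) → secantWeight A X ≤ 1
  secantWeight-≤1 A X L meet-L≤2 meet-m≤1 =
    subst (_≤ 1) (sym (trans (secantWeight-as-sum A X) (sum-allPoints-single _ L vanish))) at-L
    where
    at-L : lineWeight A X L ≤ 1
    at-L with incident X L
    ... | false = z≤n
    ... | true  = C-2-mono meet-L≤2
    vanish : ∀ m → m ≢ L → lineWeight A X m ≡ 0
    vanish m m≢L with incident X m in X∈m
    ... | false = refl
    ... | true  = n≤0⇒n≡0 (C-2-mono (meet-m≤1 m (on X∈m) m≢L))

module Configuration (K : FiniteField) where
  open import Function using (_∘_; case_of_)
  open import Data.Nat using (suc; _+_; _∸_; _≤_; _<_; z≤n; s≤s)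
  open import Data.Nat.Properties using (≤-trans; ≤-pred; +-suc; +-comm; suc-injective; n≤1+n; n<1+n; <⇒≱)
  open import Data.Bool using (Bool; true; false; _∧_; _∨_; not)
  open import Data.Bool.Properties using (∧-assoc; ∧-zeroʳ; not-¬)
  open import Data.List.Relation.Unary.All using ([]; _∷_)
  open import Data.List.Relation.Unary.AllPairs using ([]; _∷_)
  open import Data.Product using (∃; _×_; _,_; proj₁)
  open import Data.Sum using (_⊎_; inj₁; inj₂)
  open import Data.Empty using (⊥; ⊥-elim)
  open import Relation.Nullary using (¬_; Dec; yes; no)
  open import Relation.Binary.PropositionalEquality
  open Booleans using (∧≡true; ∨≡true; ∨≡true-introʳ; not≡true)
  open PointCounting K
  open LineSize K using (points-on-line)
  open SecantWeights K
  open FiniteField K using (order)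
  open PG2 K
  open Incidence K

  module Setup
    (q≥4 : 4 ≤ order)
    (ℓ : Line) (P Q R S T : Point)
    (P∈ℓ : P ∈ₗ ℓ) (Q∈ℓ : Q ∈ₗ ℓ) (P≢Q : P ≢ Q)
    (R∉ℓ : R ∉ₗ ℓ) (S∉ℓ : S ∉ₗ ℓ) (T∉ℓ : T ∉ₗ ℓ)
    (R≢S : R ≢ S) (R≢T : R ≢ T) (S≢T : S ≢ T)
    (m : Line) (P∈m : P ∈ₗ m) (R∈m : R ∈ₗ m) (S∈m : S ∈ₗ m) (T∈m : T ∈ₗ m)
    where

    A : PointSet
    A = theSet ℓ P Q R S T

    ℓ° : Point → Bool
    ℓ° X = incident X ℓ ∧ not (X == P) ∧ not (X == Q)

    data InA (Z : Point) : Set where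
      ℓ-point : Z ∈ₗ ℓ → Z ≢ P → Z ≢ Q → InA Z
      is-R    : Z ≡ R → InA Z
      is-S    : Z ≡ S → InA Z
      is-T    : Z ≡ T → InA Z

    ℓ°-view : ∀ Z → ℓ° Z ≡ true → Z ∈ₗ ℓ × Z ≢ P × Z ≢ Q
    ℓ°-view Z ℓ°Z with ∧≡true ℓ°Z
    ... | Z∈ℓ , Z≠P∧Z≠Q with ∧≡true Z≠P∧Z≠Q
    ...   | Z≠P , Z≠Q = on Z∈ℓ , ==-false⇒≢ Z P (not≡true Z≠P) , ==-false⇒≢ Z Q (not≡true Z≠Q)

    A-view : ∀ Z → A Z ≡ true → InA Z
    A-view Z AZ with ∨≡true AZ
    ... | inj₁ ℓ°Z with ℓ°-view Z ℓ°Z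
    ...   | Z∈ℓ , Z≢P , Z≢Q = ℓ-point Z∈ℓ Z≢P Z≢Q
    A-view Z AZ | inj₂ RST with ∨≡true RST
    ... | inj₁ Z==R = is-R (==⇒≡ Z R Z==R)
    ... | inj₂ ST with ∨≡true ST
    ...   | inj₁ Z==S = is-S (==⇒≡ Z S Z==S)
    ...   | inj₂ Z==T = is-T (==⇒≡ Z T Z==T)

    A-intro : ∀ {Z} → InA Z → A Z ≡ true
    A-intro {Z} (ℓ-point (on Z∈ℓ) Z≢P Z≢Q) rewrite Z∈ℓ | ≢⇒==-false Z≢P | ≢⇒==-false Z≢Q = refl
    A-intro {Z} (is-R refl) = ∨≡true-introʳ (ℓ° Z) (cong (_∨ ((Z == S) ∨ (Z == T))) (==-refl Z))
    A-intro {Z} (is-S refl) = ∨≡true-introʳ (ℓ° Z) (∨≡true-introʳ (Z == R) (cong (_∨ (Z == T)) (==-refl Z)))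
    A-intro {Z} (is-T refl) = ∨≡true-introʳ (ℓ° Z) (∨≡true-introʳ (Z == R) (∨≡true-introʳ (Z == S) (==-refl Z)))

    not-in-A : ∀ {Z} → ¬ InA Z → A Z ≡ false
    not-in-A {Z} Z∉A with A Z in AZ
    ... | true  = ⊥-elim (Z∉A (A-view Z AZ))
    ... | false = refl

    m≢ℓ : m ≢ ℓ
    m≢ℓ = ∈-∉⇒≢ₗ R∈m R∉ℓ

    m∩ℓ≡P : ∀ {Z} → Z ∈ₗ m → Z ∈ₗ ℓ → Z ≡ P
    m∩ℓ≡P Z∈m Z∈ℓ = point-unique m≢ℓ Z∈m Z∈ℓ P∈m P∈ℓ

    ℓ∌R : ∀ {Z} → Z ∈ₗ ℓ → Z ≢ R
    ℓ∌R Z∈ℓ = ∈-∉⇒≢ Z∈ℓ R∉ℓ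

    ℓ∌S : ∀ {Z} → Z ∈ₗ ℓ → Z ≢ S
    ℓ∌S Z∈ℓ = ∈-∉⇒≢ Z∈ℓ S∉ℓ

    ℓ∌T : ∀ {Z} → Z ∈ₗ ℓ → Z ≢ T
    ℓ∌T Z∈ℓ = ∈-∉⇒≢ Z∈ℓ T∉ℓ

    P∉A : A P ≡ false
    P∉A = not-in-A λ where
      (ℓ-point _ P≢P _) → P≢P refl
      (is-R P≡R)        → ℓ∌R P∈ℓ P≡R
      (is-S P≡S)        → ℓ∌S P∈ℓ P≡S
      (is-T P≡T)        → ℓ∌T P∈ℓ P≡T

    ℓ°-count : suc (suc (count ℓ°)) ≡ suc order
    ℓ°-count = begin
      suc (suc (count ℓ°))
        ≡⟨ cong (suc ∘ suc) (count-cong (λ X → sym (∧-assoc (incident X ℓ) _ _))) ⟩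
      suc (suc (count (λ X → (incident X ℓ ∧ not (X == P)) ∧ not (X == Q))))
        ≡⟨ cong suc (count-remove _ Q (cong₂ _∧_ (incident≡true Q∈ℓ) (cong not (≢⇒==-false (P≢Q ∘ sym))))) ⟨
      suc (count (λ X → incident X ℓ ∧ not (X == P)))
        ≡⟨ count-remove _ P (incident≡true P∈ℓ) ⟨
      count (λ X → incident X ℓ)
        ≡⟨ points-on-line ℓ ⟩
      suc order ∎
      where open ≡-Reasoning

    ℓ°≥3 : 3 ≤ count ℓ°
    ℓ°≥3 = ≤-pred (subst (4 ≤_) (sym (suc-injective ℓ°-count)) q≥4)

    size-A : size A ≡ order + 2
    size-A = begin
      count A
        ≡⟨ count-∨ ℓ° _ ℓ°∩RST≡∅ ⟩
      count ℓ° + count (λ X → (X == R) ∨ ((X == S) ∨ (X == T)))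
        ≡⟨ cong (count ℓ° +_) (count-∨ _ _ R∩ST≡∅) ⟩
      count ℓ° + (count (_== R) + count (λ X → (X == S) ∨ (X == T)))
        ≡⟨ cong (λ k → count ℓ° + (count (_== R) + k)) (count-∨ _ _ S∩T≡∅) ⟩
      count ℓ° + (count (_== R) + (count (_== S) + count (_== T)))
        ≡⟨ cong (count ℓ° +_) (cong₂ _+_ (count-== R) (cong₂ _+_ (count-== S) (count-== T))) ⟩
      count ℓ° + 3
        ≡⟨ +-suc (count ℓ°) 2 ⟩
      suc (count ℓ°) + 2
        ≡⟨ cong (_+ 2) (suc-injective ℓ°-count) ⟩
      order + 2 ∎
      where
      open ≡-Reasoning
      ℓ°∩RST≡∅ : ∀ X → ℓ° X ≡ true → ((X == R) ∨ ((X == S) ∨ (X == T))) ≡ true → ⊥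
      ℓ°∩RST≡∅ X ℓ°X RSTX with proj₁ (ℓ°-view X ℓ°X) | ∨≡true RSTX
      ... | X∈ℓ | inj₁ X==R = ℓ∌R X∈ℓ (==⇒≡ X R X==R)
      ... | X∈ℓ | inj₂ STX with ∨≡true STX
      ...   | inj₁ X==S = ℓ∌S X∈ℓ (==⇒≡ X S X==S)
      ...   | inj₂ X==T = ℓ∌T X∈ℓ (==⇒≡ X T X==T)
      R∩ST≡∅ : ∀ X → (X == R) ≡ true → ((X == S) ∨ (X == T)) ≡ true → ⊥
      R∩ST≡∅ X X==R STX with ∨≡true STX
      ... | inj₁ X==S = R≢S (trans (sym (==⇒≡ X R X==R)) (==⇒≡ X S X==S))
      ... | inj₂ X==T = R≢T (trans (sym (==⇒≡ X R X==R)) (==⇒≡ X T X==T))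
      S∩T≡∅ : ∀ X → (X == S) ≡ true → (X == T) ≡ true → ⊥
      S∩T≡∅ X X==S X==T = S≢T (trans (sym (==⇒≡ X S X==S)) (==⇒≡ X T X==T))

    spans : Spans A
    spans (n , A⊆n) with count-positive ℓ° (≤-trans (s≤s z≤n) ℓ°≥3)
    ... | Y , ℓ°Y with ℓ°-view Y ℓ°Y
    ...   | Y∈ℓ , Y≢P , Y≢Q = Y≢P (m∩ℓ≡P (subst (Y ∈ₗ_) n≡m (on-n (ℓ-point Y∈ℓ Y≢P Y≢Q))) Y∈ℓ)
      where
      on-n : ∀ {Z} → InA Z → Z ∈ₗ n
      on-n {Z} Z∈A = on (A⊆n Z (A-intro Z∈A))
      n≡m : n ≡ m
      n≡m = line-unique R≢S (on-n (is-R refl)) (on-n (is-S refl)) R∈m S∈m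

    m-rich : 3 ≤ meet A m
    m-rich = meet-≥ A m ((R≢S ∷ R≢T ∷ []) ∷ (S≢T ∷ []) ∷ [] ∷ [])
      ((R∈m , A-intro (is-R refl)) ∷ (S∈m , A-intro (is-S refl)) ∷ (T∈m , A-intro (is-T refl)) ∷ [])

    ℓ-rich : 3 ≤ meet A ℓ
    ℓ-rich = ≤-trans ℓ°≥3 (count-mono ℓ°⊆ℓ∩A)
      where
      ℓ°⊆ℓ∩A : ∀ X → ℓ° X ≡ true → (incident X ℓ ∧ A X) ≡ true
      ℓ°⊆ℓ∩A X ℓ°X with ℓ°-view X ℓ°X
      ... | X∈ℓ , X≢P , X≢Q = cong₂ _∧_ (incident≡true X∈ℓ) (A-intro (ℓ-point X∈ℓ X≢P X≢Q))

    module OffBothLines (X : Point) (X∉ℓ : X ∉ₗ ℓ) (X∉m : X ∉ₗ m) where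

      joinX : ∀ {U} → U ∈ₗ m → Line
      joinX U∈m = line X _ (≢-sym (∈-∉⇒≢ U∈m X∉m))

      X∈joinX : ∀ {U} (U∈m : U ∈ₗ m) → X ∈ₗ joinX U∈m
      X∈joinX U∈m = line-∈ˡ _

      U∈joinX : ∀ {U} (U∈m : U ∈ₗ m) → U ∈ₗ joinX U∈m
      U∈joinX U∈m = line-∈ʳ _

      foot : ∀ {U} → U ∈ₗ m → Point
      foot U∈m = meet-point (joinX U∈m) ℓ (∈-∉⇒≢ₗ (X∈joinX U∈m) X∉ℓ)

      foot∈joinX : ∀ {U} (U∈m : U ∈ₗ m) → foot U∈m ∈ₗ joinX U∈m
      foot∈joinX U∈m = meet-point-∈ˡ _

      foot∈ℓ : ∀ {U} (U∈m : U ∈ₗ m) → foot U∈m ∈ₗ ℓ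
      foot∈ℓ U∈m = meet-point-∈ʳ _

      joinX-injective : ∀ {U V} (U∈m : U ∈ₗ m) (V∈m : V ∈ₗ m) → U ≢ V → joinX U∈m ≢ joinX V∈m
      joinX-injective U∈m V∈m U≢V same = X∉m (subst (X ∈ₗ_) joinX≡m (X∈joinX U∈m))
        where
        joinX≡m : joinX U∈m ≡ m
        joinX≡m = line-unique U≢V (U∈joinX U∈m) (subst (_ ∈ₗ_) (sym same) (U∈joinX V∈m)) U∈m V∈m

      foot-injective : ∀ {U V} (U∈m : U ∈ₗ m) (V∈m : V ∈ₗ m) → U ≢ V → foot U∈m ≢ foot V∈m
      foot-injective U∈m V∈m U≢V same = joinX-injective U∈m V∈m U≢V joinX≡joinX
        where
        X≢foot : X ≢ foot U∈m
        X≢foot X≡foot = X∉ℓ (subst (_∈ₗ ℓ) (sym X≡foot) (foot∈ℓ U∈m))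
        joinX≡joinX : joinX U∈m ≡ joinX V∈m
        joinX≡joinX = line-unique X≢foot (X∈joinX U∈m) (foot∈joinX U∈m)
          (X∈joinX V∈m) (subst (_∈ₗ joinX V∈m) (sym same) (foot∈joinX V∈m))

      foot≢P : ∀ {U} (U∈m : U ∈ₗ m) → U ∉ₗ ℓ → foot U∈m ≢ P
      foot≢P U∈m U∉ℓ foot≡P = X∉m (subst (X ∈ₗ_) joinX≡m (X∈joinX U∈m))
        where
        joinX≡m : joinX U∈m ≡ m
        joinX≡m = line-unique (∈-∉⇒≢ P∈ℓ U∉ℓ)
          (subst (_∈ₗ joinX U∈m) foot≡P (foot∈joinX U∈m)) (U∈joinX U∈m) P∈m U∈m

      secant : ∀ {U} (U∈m : U ∈ₗ m) → U ∉ₗ ℓ → A U ≡ true → foot U∈m ≢ Q → 2 ≤ meet A (joinX U∈m)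
      secant U∈m U∉ℓ U∈A foot≢Q = meet-≥ A _ ((∈-∉⇒≢ (foot∈ℓ U∈m) U∉ℓ ∷ []) ∷ [] ∷ [])
        ( (foot∈joinX U∈m , A-intro (ℓ-point (foot∈ℓ U∈m) (foot≢P U∈m U∉ℓ) foot≢Q))
        ∷ (U∈joinX U∈m , U∈A) ∷ [])

      two-secants : ∀ {U V} (U∈m : U ∈ₗ m) (V∈m : V ∈ₗ m) → U ≢ V → U ∉ₗ ℓ → V ∉ₗ ℓ →
        A U ≡ true → A V ≡ true →
        foot U∈m ≢ Q → foot V∈m ≢ Q → 2 ≤ secantWeight A X
      two-secants U∈m V∈m U≢V U∉ℓ V∉ℓ U∈A V∈A foot-U≢Q foot-V≢Q =
        secantWeight-≥-two-secants A (joinX-injective U∈m V∈m U≢V) (X∈joinX U∈m) (X∈joinX V∈m)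
          (secant U∈m U∉ℓ U∈A foot-U≢Q) (secant V∈m V∉ℓ V∈A foot-V≢Q)

      -- the feet of XR, XS, XT are distinct, so at most one of them is Q
      saturated : 2 ≤ secantWeight A X
      saturated = by-cases (foot R∈m ≟ᴾ Q) (foot S∈m ≟ᴾ Q)
        where
        by-cases : Dec (foot R∈m ≡ Q) → Dec (foot S∈m ≡ Q) → 2 ≤ secantWeight A X
        by-cases (yes R′≡Q) _ = two-secants S∈m T∈m S≢T S∉ℓ T∉ℓ (A-intro (is-S refl)) (A-intro (is-T refl))
          (λ S′≡Q → foot-injective R∈m S∈m R≢S (trans R′≡Q (sym S′≡Q)))
          (λ T′≡Q → foot-injective R∈m T∈m R≢T (trans R′≡Q (sym T′≡Q)))
        by-cases (no R′≢Q) (yes S′≡Q) = two-secants R∈m T∈m R≢T R∉ℓ T∉ℓ (A-intro (is-R refl)) (A-intro (is-T refl))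
          R′≢Q (λ T′≡Q → foot-injective S∈m T∈m S≢T (trans S′≡Q (sym T′≡Q)))
        by-cases (no R′≢Q) (no S′≢Q) = two-secants R∈m S∈m R≢S R∉ℓ S∉ℓ (A-intro (is-R refl)) (A-intro (is-S refl))
          R′≢Q S′≢Q

    saturating : Saturating 2 A
    saturating = spans , (P , P∉A) , saturated
      where
      saturated : ∀ X → A X ≡ false → 2 ≤ secantWeight A X
      saturated X X∉A = by-cases (X ∈ₗ? m) (X ∈ₗ? ℓ) (X ≟ᴾ Q)
        where
        by-cases : Dec (X ∈ₗ m) → Dec (X ∈ₗ ℓ) → Dec (X ≡ Q) → 2 ≤ secantWeight A X
        by-cases (yes X∈m) _         _          = ≤-trans (n≤1+n 2) (secantWeight-≥-rich-line A X∈m m-rich)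
        by-cases (no X∉m)  (no X∉ℓ)  _          = OffBothLines.saturated X X∉ℓ X∉m
        by-cases (no _)    (yes _)   (yes refl) = ≤-trans (n≤1+n 2) (secantWeight-≥-rich-line A Q∈ℓ ℓ-rich)
        by-cases (no X∉m)  (yes X∈ℓ) (no X≢Q)   =
          ⊥-elim (not-¬ (A-intro (ℓ-point X∈ℓ (λ X≡P → X∉m (subst (_∈ₗ m) (sym X≡P) P∈m)) X≢Q)) X∉A)

    _∖_ : PointSet → Point → PointSet
    (A′ ∖ Y) Z = A′ Z ∧ not (Z == Y)

    ∖-view : ∀ Y Z → (A ∖ Y) Z ≡ true → InA Z × Z ≢ Y
    ∖-view Y Z A∖Y-Z with ∧≡true A∖Y-Z
    ... | AZ , Z≠Y = A-view Z AZ , ==-false⇒≢ Z Y (not≡true Z≠Y)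

    ∖-self : ∀ Y → (A ∖ Y) Y ≡ false
    ∖-self Y = trans (cong (λ b → A Y ∧ not b) (==-refl Y)) (∧-zeroʳ (A Y))

    not-in-A∖ : ∀ {Y} Z → ¬ InA Z → (A ∖ Y) Z ≡ false
    not-in-A∖ Z Z∉A = cong (_∧ _) (not-in-A Z∉A)

    ⊆-false : ∀ {A′ B X} → B ⊆ A′ → A′ X ≡ false → B X ≡ false
    ⊆-false {A′} {B} {X} B⊆A′ A′X with B X in BX
    ... | true  = ⊥-elim (not-¬ (B⊆A′ X BX) A′X)
    ... | false = refl

    Deficient : PointSet → Set
    Deficient A′ = ∃ λ X → A′ X ≡ false × secantWeight A′ X ≤ 1

    corner : ∀ {U V W} → U ∈ₗ m → V ∈ₗ m → W ∈ₗ m → U ∉ₗ ℓ → U ≢ V → U ≢ W → (A′ : PointSet) →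
      (∀ Z → A′ Z ≡ true → (Z ∈ₗ ℓ × Z ≢ P) ⊎ Z ≡ V ⊎ Z ≡ W) → secantWeight A′ U ≤ 1
    corner {U} {V} {W} U∈m V∈m W∈m U∉ℓ U≢V U≢W A′ A′-view = secantWeight-≤1 A′ U m on-m off-m
      where
      on-m : meet A′ m ≤ 2
      on-m = meet-≤2 A′ m V W λ Z Z∈m A′Z → case A′-view Z A′Z of λ where
        (inj₁ (Z∈ℓ , Z≢P)) → ⊥-elim (Z≢P (m∩ℓ≡P Z∈m Z∈ℓ))
        (inj₂ Z≡V⊎Z≡W)     → Z≡V⊎Z≡W
      off-m : ∀ n → U ∈ₗ n → n ≢ m → meet A′ n ≤ 1
      off-m n U∈n n≢m = meet-≤1 A′ n (meet-point n ℓ n≢ℓ) λ Z Z∈n A′Z → case A′-view Z A′Z of λ where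
          (inj₁ (Z∈ℓ , _))  → point-unique n≢ℓ Z∈n Z∈ℓ (meet-point-∈ˡ n≢ℓ) (meet-point-∈ʳ n≢ℓ)
          (inj₂ (inj₁ refl)) → ⊥-elim (n≢m (line-unique U≢V U∈n Z∈n U∈m V∈m))
          (inj₂ (inj₂ refl)) → ⊥-elim (n≢m (line-unique U≢W U∈n Z∈n U∈m W∈m))
        where
        n≢ℓ : n ≢ ℓ
        n≢ℓ = ∈-∉⇒≢ₗ U∈n U∉ℓ

    module Edge (Y : Point) (Y∈ℓ : Y ∈ₗ ℓ) (Y≢P : Y ≢ P) (Y≢Q : Y ≢ Q) where

      a b : Line
      a = line Y R (ℓ∌R Y∈ℓ)
      b = line Q S (ℓ∌S Q∈ℓ)

      Y∈a : Y ∈ₗ a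
      Y∈a = line-∈ˡ _

      R∈a : R ∈ₗ a
      R∈a = line-∈ʳ _

      Q∈b : Q ∈ₗ b
      Q∈b = line-∈ˡ _

      S∈b : S ∈ₗ b
      S∈b = line-∈ʳ _

      a∩ℓ≡Y : ∀ {Z} → Z ∈ₗ a → Z ∈ₗ ℓ → Z ≡ Y
      a∩ℓ≡Y Z∈a Z∈ℓ = point-unique (∈-∉⇒≢ₗ R∈a R∉ℓ) Z∈a Z∈ℓ Y∈a Y∈ℓ

      b∩ℓ≡Q : ∀ {Z} → Z ∈ₗ b → Z ∈ₗ ℓ → Z ≡ Q
      b∩ℓ≡Q Z∈b Z∈ℓ = point-unique (∈-∉⇒≢ₗ S∈b S∉ℓ) Z∈b Z∈ℓ Q∈b Q∈ℓ

      a≢b : a ≢ b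
      a≢b a≡b = Y≢Q (sym (a∩ℓ≡Y (subst (Q ∈ₗ_) (sym a≡b) Q∈b) Q∈ℓ))

      S∉a : S ∉ₗ a
      S∉a S∈a = Y≢P (m∩ℓ≡P (subst (Y ∈ₗ_) (line-unique R≢S R∈a S∈a R∈m S∈m) Y∈a) Y∈ℓ)

      T∉a : T ∉ₗ a
      T∉a T∈a = Y≢P (m∩ℓ≡P (subst (Y ∈ₗ_) (line-unique R≢T R∈a T∈a R∈m T∈m) Y∈a) Y∈ℓ)

      R∉b : R ∉ₗ b
      R∉b R∈b = P≢Q (sym (m∩ℓ≡P (subst (Q ∈ₗ_) (line-unique R≢S R∈b S∈b R∈m S∈m) Q∈b) Q∈ℓ))

      T∉b : T ∉ₗ b
      T∉b T∈b = P≢Q (sym (m∩ℓ≡P (subst (Q ∈ₗ_) (line-unique S≢T S∈b T∈b S∈m T∈m) Q∈b) Q∈ℓ))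

      X₀ : Point
      X₀ = meet-point a b a≢b

      X₀∈a : X₀ ∈ₗ a
      X₀∈a = meet-point-∈ˡ a≢b

      X₀∈b : X₀ ∈ₗ b
      X₀∈b = meet-point-∈ʳ a≢b

      X₀∉ℓ : X₀ ∉ₗ ℓ
      X₀∉ℓ X₀∈ℓ = Y≢Q (trans (sym (a∩ℓ≡Y X₀∈a X₀∈ℓ)) (b∩ℓ≡Q X₀∈b X₀∈ℓ))

      X₀≢R : X₀ ≢ R
      X₀≢R = ∈-∉⇒≢ X₀∈b R∉b

      X₀≢S : X₀ ≢ S
      X₀≢S = ∈-∉⇒≢ X₀∈a S∉a

      X₀≢T : X₀ ≢ T
      X₀≢T = ∈-∉⇒≢ X₀∈a T∉a

      X₀∉A : ¬ InA X₀
      X₀∉A (ℓ-point X₀∈ℓ _ _) = X₀∉ℓ X₀∈ℓ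
      X₀∉A (is-R X₀≡R)       = X₀≢R X₀≡R
      X₀∉A (is-S X₀≡S)       = X₀≢S X₀≡S
      X₀∉A (is-T X₀≡T)       = X₀≢T X₀≡T

      L : Line
      L = line X₀ T X₀≢T

      -- A line through X₀ other than L meets A ∖ Y only in R (if it is a), only in S (if it is b),
      -- or otherwise only in its point on ℓ.
      off-L : ∀ n → X₀ ∈ₗ n → n ≢ L → meet (A ∖ Y) n ≤ 1
      off-L n X₀∈n n≢L = by-cases (R ∈ₗ? n) (S ∈ₗ? n)
        where
        T∉n : T ∉ₗ n
        T∉n T∈n = n≢L (line-unique X₀≢T X₀∈n T∈n (line-∈ˡ X₀≢T) (line-∈ʳ X₀≢T))
        n≢ℓ : n ≢ ℓ
        n≢ℓ = ∈-∉⇒≢ₗ X₀∈n X₀∉ℓ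
        by-cases : Dec (R ∈ₗ n) → Dec (S ∈ₗ n) → meet (A ∖ Y) n ≤ 1
        by-cases (yes R∈n) _ = meet-≤1 (A ∖ Y) n R λ Z Z∈n Z∈A∖Y → case ∖-view Y Z Z∈A∖Y of λ where
            (ℓ-point Z∈ℓ _ _ , Z≢Y) → ⊥-elim (Z≢Y (a∩ℓ≡Y (subst (Z ∈ₗ_) n≡a Z∈n) Z∈ℓ))
            (is-R Z≡R , _)          → Z≡R
            (is-S refl , _)         → ⊥-elim (S∉a (subst (Z ∈ₗ_) n≡a Z∈n))
            (is-T refl , _)         → ⊥-elim (T∉n Z∈n)
          where
          n≡a : n ≡ a
          n≡a = line-unique X₀≢R X₀∈n R∈n X₀∈a R∈a
        by-cases (no R∉n) (yes S∈n) = meet-≤1 (A ∖ Y) n S λ Z Z∈n Z∈A∖Y → case ∖-view Y Z Z∈A∖Y of λ where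
            (ℓ-point Z∈ℓ _ Z≢Q , _) → ⊥-elim (Z≢Q (b∩ℓ≡Q (subst (Z ∈ₗ_) n≡b Z∈n) Z∈ℓ))
            (is-R refl , _)         → ⊥-elim (R∉n Z∈n)
            (is-S Z≡S , _)          → Z≡S
            (is-T refl , _)         → ⊥-elim (T∉n Z∈n)
          where
          n≡b : n ≡ b
          n≡b = line-unique X₀≢S X₀∈n S∈n X₀∈b S∈b
        by-cases (no R∉n) (no S∉n) =
          meet-≤1 (A ∖ Y) n (meet-point n ℓ n≢ℓ) λ Z Z∈n Z∈A∖Y → case ∖-view Y Z Z∈A∖Y of λ where
            (ℓ-point Z∈ℓ _ _ , _) → point-unique n≢ℓ Z∈n Z∈ℓ (meet-point-∈ˡ n≢ℓ) (meet-point-∈ʳ n≢ℓ)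
            (is-R refl , _)       → ⊥-elim (R∉n Z∈n)
            (is-S refl , _)       → ⊥-elim (S∉n Z∈n)
            (is-T refl , _)       → ⊥-elim (T∉n Z∈n)

      on-L : meet (A ∖ Y) L ≤ 2
      on-L = meet-≤2 (A ∖ Y) L (meet-point L ℓ L≢ℓ) T λ Z Z∈L Z∈A∖Y → case ∖-view Y Z Z∈A∖Y of λ where
          (ℓ-point Z∈ℓ _ _ , _) → inj₁ (point-unique L≢ℓ Z∈L Z∈ℓ (meet-point-∈ˡ L≢ℓ) (meet-point-∈ʳ L≢ℓ))
          (is-R refl , _)       → ⊥-elim (T∉a (subst (T ∈ₗ_) (line-unique X₀≢R X₀∈L Z∈L X₀∈a R∈a) T∈L))
          (is-S refl , _)       → ⊥-elim (T∉b (subst (T ∈ₗ_) (line-unique X₀≢S X₀∈L Z∈L X₀∈b S∈b) T∈L))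
          (is-T Z≡T , _)        → inj₂ Z≡T
        where
        X₀∈L : X₀ ∈ₗ L
        X₀∈L = line-∈ˡ X₀≢T
        T∈L : T ∈ₗ L
        T∈L = line-∈ʳ X₀≢T
        L≢ℓ : L ≢ ℓ
        L≢ℓ = ∈-∉⇒≢ₗ X₀∈L X₀∉ℓ

      deficient : Deficient (A ∖ Y)
      deficient = X₀ , not-in-A∖ X₀ X₀∉A , secantWeight-≤1 (A ∖ Y) X₀ L on-L off-L

    deficient : ∀ Y → InA Y → Deficient (A ∖ Y)
    deficient Y (ℓ-point Y∈ℓ Y≢P Y≢Q) = Edge.deficient Y Y∈ℓ Y≢P Y≢Q
    deficient Y (is-R refl) = R , ∖-self R ,
      corner R∈m S∈m T∈m R∉ℓ R≢S R≢T (A ∖ R) λ Z Z∈A∖R →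
        case ∖-view R Z Z∈A∖R of λ where
          (ℓ-point Z∈ℓ Z≢P _ , _) → inj₁ (Z∈ℓ , Z≢P)
          (is-R Z≡R , Z≢R)        → ⊥-elim (Z≢R Z≡R)
          (is-S Z≡S , _)          → inj₂ (inj₁ Z≡S)
          (is-T Z≡T , _)          → inj₂ (inj₂ Z≡T)
    deficient Y (is-S refl) = S , ∖-self S ,
      corner S∈m R∈m T∈m S∉ℓ (R≢S ∘ sym) S≢T (A ∖ S) λ Z Z∈A∖S →
        case ∖-view S Z Z∈A∖S of λ where
          (ℓ-point Z∈ℓ Z≢P _ , _) → inj₁ (Z∈ℓ , Z≢P)
          (is-R Z≡R , _)          → inj₂ (inj₁ Z≡R)
          (is-S Z≡S , Z≢S)        → ⊥-elim (Z≢S Z≡S)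
          (is-T Z≡T , _)          → inj₂ (inj₂ Z≡T)
    deficient Y (is-T refl) = T , ∖-self T ,
      corner T∈m R∈m S∈m T∉ℓ (R≢T ∘ sym) (S≢T ∘ sym) (A ∖ T) λ Z Z∈A∖T →
        case ∖-view T Z Z∈A∖T of λ where
          (ℓ-point Z∈ℓ Z≢P _ , _) → inj₁ (Z∈ℓ , Z≢P)
          (is-R Z≡R , _)          → inj₂ (inj₁ Z≡R)
          (is-S Z≡S , _)          → inj₂ (inj₂ Z≡S)
          (is-T Z≡T , Z≢T)        → ⊥-elim (Z≢T Z≡T)

    minimal : ∀ B → B ⊆ A → size B ≡ size A ∸ 1 → ¬ Saturating 2 B
    minimal B B⊆A size-B (_ , _ , B-saturated) = refute (⊂-witness B⊆A size-B<size-A)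
      where
      size-A′ : size A ≡ suc (suc order)
      size-A′ = trans size-A (+-comm order 2)
      size-B<size-A : size B < size A
      size-B<size-A = subst₂ _<_ (sym (trans size-B (cong (_∸ 1) size-A′))) (sym size-A′) (n<1+n (suc order))
      refute : (∃ λ Y → A Y ≡ true × B Y ≡ false) → ⊥
      refute (Y , AY , BY) = unsaturated (deficient Y (A-view Y AY))
        where
        B⊆A∖Y : B ⊆ (A ∖ Y)
        B⊆A∖Y Z BZ = cong₂ _∧_ (B⊆A Z BZ) (cong not (≢⇒==-false {Z} {Y} λ { refl → not-¬ BZ BY }))
        unsaturated : Deficient (A ∖ Y) → ⊥
        unsaturated (X , X∉A∖Y , weight≤1) = <⇒≱ (n<1+n 1)
          (≤-trans (B-saturated X (⊆-false B⊆A∖Y X∉A∖Y)) (≤-trans (secantWeight-mono B⊆A∖Y X) weight≤1))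

    minimal-saturating : MinimalSaturating 2 A
    minimal-saturating = saturating , minimal

open import Data.Nat using (_≤_; _+_)
open import Data.Bool using (true; false)
open import Data.Product using (_×_; _,_)
open import Relation.Binary.PropositionalEquality using (_≡_; _≢_)
open FiniteField using (order)
open PG2

theorem6p6 : (K : FiniteField) → 4 ≤ order K →
    (ℓ : Line K) (P Q R S T : Point K) →
    incident K P ℓ ≡ true → incident K Q ℓ ≡ true → P ≢ Q →
    incident K R ℓ ≡ false → incident K S ℓ ≡ false → incident K T ℓ ≡ false →
    R ≢ S → R ≢ T → S ≢ T →
    (m : Line K) → incident K P m ≡ true → incident K R m ≡ true →
      incident K S m ≡ true → incident K T m ≡ true →
    MinimalSaturating K 2 (theSet K ℓ P Q R S T)
      × size K (theSet K ℓ P Q R S T) ≡ order K + 2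
theorem6p6 K q≥4 ℓ P Q R S T P∈ℓ Q∈ℓ P≢Q R∉ℓ S∉ℓ T∉ℓ R≢S R≢T S≢T m P∈m R∈m S∈m T∈m =
  minimal-saturating , size-A
  where
  open Incidence K using (on; ∉ₗ-from-false)
  open Configuration.Setup K q≥4 ℓ P Q R S T (on P∈ℓ) (on Q∈ℓ) P≢Q
    (∉ₗ-from-false R∉ℓ) (∉ₗ-from-false S∉ℓ) (∉ₗ-from-false T∉ℓ) R≢S R≢T S≢T
    m (on P∈m) (on R∈m) (on S∈m) (on T∈m)
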